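{- Let $m\in\mathbb N$ and suppose the non-empty finite sets $A_1,\dots,A_m\subset\mathbb N$ form an $m$-part non-inclusive sum-and-distance system. For $j\in\{1,\dots,m\}$ let \[\tilde A_j:=\tfrac12\max A_j+\tfrac12\bigl(A_j\cup(-A_j)\bigr)=\Bigl\{\tfrac{\max A_j-a}{2},\tfrac{\max A_j+a}{2}: a\in A_j\Bigr\}.\] Then $\tilde A_1,\dots,\tilde A_m$ form an $m$-part sum system in which every component set has even cardinality. Conversely, suppose $\tilde A_1,\dots,\tilde A_m\subset\mathbb N_0$ form an $m$-part sum system in which every component set has even cardinality. For each $j$, write the elements of $\tilde A_j$ as $0=\alpha_1<\alpha_2<\dots<\alpha_{2\nu_j}$ and let \[A_j:=\{\alpha_{\nu_j+k}-\alpha_{\nu_j+1-k}: k\in\{1,\dots,\nu_j\}\}.\] Then $A_1,\dots,A_m$ form an $m$-part non-inclusive sum-and-distance system.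
   Context: $\mathbb N=\{1,2,\dots\}$, $\mathbb N_0=\mathbb N\cup\{0\}$, and for $N\in\mathbb N$, $\langle N\rangle:=\{0,1,\dots,N-1\}$. For sets $A,B\subset\mathbb R$ and reals $a,b$: $A+B=\{x+y:x\in A,y\in B\}$, $aA+b=\{ax+b:x\in A\}$, $-A=\{ -x:x\in A\}$; $|A|$ is cardinality. An $m$-part sum system is a collection of finite sets $A_1,\dots,A_m\subset\mathbb N_0$, each of cardinality at least 2, with $\sum_{k=1}^m A_k=\langle\prod_{k=1}^m|A_k|\rangle$. Finite sets $A_1,\dots,A_m\subset\mathbb N$ form an $m$-part non-inclusive sum-and-distance system if \[\sum_{j=1}^m\bigl(A_j\cup(-A_j)\bigr)=2\Bigl\langle 2^m\prod_{j=1}^m|A_j|\Bigr\rangle-2^m\prod_{j=1}^m|A_j|+1.\] -}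

module Defs where

open import Function using (_∘_; _⇔_)
open import Data.Nat as ℕ using (ℕ; zero; suc; _<_; _≤_; _⊔_; _∸_; _^_)
open import Data.Nat.Properties using (≤-decTotalOrder)
open import Data.Integer as ℤ using (ℤ; +_)
open import Data.Rational as ℚ using (ℚ)
open import Data.Fin using (Fin)
import Data.Fin as F
open import Data.List using (List; []; _∷_; length; map; foldr; deduplicate; concatMap; _++_; upTo)
open import Data.List.Membership.Propositional using (_∈_)
open import Data.Product using (Σ; ∃; ∃-syntax; _×_; _,_)
open import Relation.Binary.PropositionalEquality using (_≡_)
open import Data.List.Sort ≤-decTotalOrder using (sort)

-- Finite sets are represented by lists; a list denotes the set of its
-- members (x ∈ xs).  Repetitions are allowed; cardinality counts
-- distinct members.

cardℕ : List ℕ → ℕ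
cardℕ xs = length (deduplicate ℕ._≟_ xs)

sumF : {X : Set} → (X → X → X) → X → {m : ℕ} → (Fin m → X) → X
sumF _⊕_ e {zero}  f = e
sumF _⊕_ e {suc m} f = f F.zero ⊕ sumF _⊕_ e (f ∘ F.suc)

prodℕ : {m : ℕ} → (Fin m → ℕ) → ℕ
prodℕ {zero}  f = 1
prodℕ {suc m} f = f F.zero ℕ.* prodℕ (f ∘ F.suc)

InSumset : {X : Set} → (X → X → X) → X → {m : ℕ} → (Fin m → List X) → X → Set
InSumset _⊕_ e {m} A x =
  Σ (Fin m → _) λ f → ((j : Fin m) → f j ∈ A j) × (x ≡ sumF _⊕_ e f)

SumSystem : {m : ℕ} → (Fin m → List ℕ) → Set
SumSystem {m} A =
  ((j : Fin m) → 2 ≤ cardℕ (A j)) ×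
  ((n : ℕ) → InSumset ℕ._+_ 0 A n ⇔ (n < prodℕ (λ j → cardℕ (A j))))

symm : List ℕ → List ℤ
symm A = map +_ A ++ map (λ a → ℤ.- (+ a)) A

NonInclusiveSAD : {m : ℕ} → (Fin m → List ℕ) → Set
NonInclusiveSAD {m} A =
  ((j : Fin m) → (a : ℕ) → a ∈ A j → 1 ≤ a) ×
  ((z : ℤ) → InSumset ℤ._+_ (+ 0) (λ j → symm (A j)) z
             ⇔ (∃[ k ] (k < P × z ≡ (+ (2 ℕ.* k) ℤ.- + P) ℤ.+ + 1)))
  where P = 2 ^ m ℕ.* prodℕ (λ j → cardℕ (A j))

maxℕ : List ℕ → ℕ
maxℕ = foldr _⊔_ 0

tilde : List ℕ → List ℚ
tilde A = concatMap (λ a → ((+ M ℤ.- + a) ℚ./ 2) ∷ ((+ M ℤ.+ + a) ℚ./ 2) ∷ []) A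
  where M = maxℕ A

ℕtoℚ : ℕ → ℚ
ℕtoℚ n = (+ n) ℚ./ 1

-- Converse construction: write the elements of Ã as
-- α₁ < α₂ < ⋯ < α_{2ν} (here 0-indexed: s = sorted distinct elements)
-- and put A = { α_{ν+k} - α_{ν+1-k} : k = 1..ν }.

-- list lookup with default 0 (only used in range)
nth : List ℕ → ℕ → ℕ
nth []       _       = 0
nth (x ∷ xs) zero    = x
nth (x ∷ xs) (suc i) = nth xs i

sortedElems : List ℕ → List ℕ
sortedElems xs = sort (deduplicate ℕ._≟_ xs)

untilde : List ℕ → List ℕ
untilde T = map (λ k → nth s (ν ℕ.+ k) ∸ nth s (ν ∸ suc k)) (upTo ν)
  where
  s = sortedElems T
  ν = length s ℕ./ 2

module Submission where

-- Both directions rest on one transfer principle (module CentredSums): if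
-- Sⱼ = 2Tⱼ - Mⱼ with Sⱼ ⊂ ℤ, Tⱼ ⊂ ℕ and Σ Mⱼ = P - 1, then
-- S₁ + ⋯ + Sₘ = 2⟨P⟩ - P + 1 exactly when T₁ + ⋯ + Tₘ = ⟨P⟩.

open import Defs
open import Function using (_∘_; _⇔_; mk⇔; const; Equivalence)
open import Level using (0ℓ)
open import Algebra.Bundles using (CommutativeMonoid)
open import Data.Nat
open import Data.Nat.Properties
open import Data.Nat.Induction using (<-rec)
open import Data.Nat.Tactic.RingSolver using (solve-∀)
open import Data.Nat.DivMod using (_/_; _%_; m≡m%n+[m/n]*n; m%n<n; m*n/n≡m)
open import Data.Nat.Divisibility using (_∣_; divides; m∣n⇒n≡quotient*m; quotient)
open import Data.Integer as ℤ using (ℤ; +_)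
open import Data.Integer.Properties using (pos-+; pos-*; +-injective; drop‿+≤+; neg-≤-pos)
import Data.Integer.Properties as ℤ
import Data.Integer.Tactic.RingSolver as ℤ-Solver
open import Data.Rational as ℚ using (ℚ)
open import Data.Rational.Properties using (fromℚᵘ-cong)
open import Data.Rational.Unnormalised using (mkℚᵘ; *≡*)
open import Data.Fin using (Fin; zero; suc)
open import Data.Fin.Properties using () renaming (_≟_ to _≟ᶠ_)
open import Data.Vec.Functional using (updateAt)
open import Data.Vec.Functional.Properties using (updateAt-updates; updateAt-minimal)
open import Data.List using (List; []; _∷_; length; map; concatMap; deduplicate; _++_; filter; upTo)
open import Data.List.Properties
  using (length-++; length-map; length-filter; length-deduplicate; filter-complete; length-upTo; map-upTo)
open import Data.List.Membership.Propositional using (_∈_; find; lose)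
open import Data.List.Membership.Propositional.Properties
  using ( ∈-map⁺; ∈-map⁻; ∈-concat⁺′; ∈-concatMap⁺; ∈-concatMap⁻; ∈-++⁺ˡ; ∈-++⁺ʳ; ∈-++⁻
        ; ∈-deduplicate⁺; ∈-deduplicate⁻; ∈-filter⁺; ∈-filter⁻; ∈-upTo⁺; ∈-upTo⁻)
open import Data.List.Membership.Propositional.Properties.WithK using (unique∧set⇒bag)
open import Data.List.Membership.DecPropositional _≟_ using (_∈?_)
open import Data.List.Relation.Unary.Any using (here; there)
open import Data.List.Relation.Unary.All as All using (All; []; _∷_)
import Data.List.Relation.Unary.All.Properties as All
open import Data.List.Relation.Unary.AllPairs as AllPairs using (AllPairs; []; _∷_)
open import Data.List.Relation.Unary.Linked.Properties using (Linked⇒AllPairs)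
open import Data.List.Relation.Unary.Unique.Propositional using (Unique)
import Data.List.Relation.Unary.Unique.Propositional.Properties as Unique
open import Data.List.Relation.Unary.Unique.DecPropositional.Properties _≟_ using (deduplicate-!)
open import Data.List.Relation.Binary.BagAndSetEquality using (∼bag⇒↭)
open import Data.List.Relation.Binary.Permutation.Propositional using (↭-sym; ↭⇒↭ₛ)
open import Data.List.Relation.Binary.Permutation.Propositional.Properties using (↭-length; ∈-resp-↭)
import Data.List.Relation.Binary.Permutation.Setoid.Properties as Permutation
open import Data.List.Sort ≤-decTotalOrder using (sort-↭; sort-↗)
open import Data.Product using (Σ; ∃-syntax; _×_; _,_; proj₁; proj₂)
open import Data.Sum using (_⊎_; inj₁; inj₂)
open import Data.Empty using (⊥-elim)
open import Relation.Nullary using (Dec; yes; no; ¬_; ¬?)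
open import Relation.Binary using (tri<; tri≈; tri>)
open import Relation.Binary.PropositionalEquality
import Relation.Binary.Reasoning.Setoid as ≈-Reasoning

block-< : ∀ d {q q' r r'} → r < d → q < q' → d * q + r < d * q' + r'
block-< d {q} {q'} {r} {r'} r<d q<q' = begin-strict
  d * q + r   <⟨ +-monoʳ-< (d * q) r<d ⟩
  d * q + d   ≡⟨ +-comm (d * q) d ⟩
  d + d * q   ≡⟨ sym (*-suc d q) ⟩
  d * suc q   ≤⟨ *-monoʳ-≤ d q<q' ⟩
  d * q'      ≤⟨ m≤m+n (d * q') r' ⟩
  d * q' + r' ∎
  where open ≤-Reasoning

digits-unique : ∀ d {q q' r r'} → r < d → r' < d →
                d * q + r ≡ d * q' + r' → q ≡ q' × r ≡ r'
digits-unique d {q} {q'} r<d r'<d e with <-cmp q q'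
... | tri≈ _ refl _ = refl , +-cancelˡ-≡ (d * q) _ _ e
... | tri< q<q' _ _ = ⊥-elim (<⇒≢ (block-< d r<d q<q') e)
... | tri> _ _ q'<q = ⊥-elim (<⇒≢ (block-< d r'<d q'<q) (sym e))

div-mod : ∀ d .{{_ : NonZero d}} x → d * (x / d) + x % d ≡ x
div-mod d x = begin
  d * (x / d) + x % d ≡⟨ +-comm (d * (x / d)) (x % d) ⟩
  x % d + d * (x / d) ≡⟨ cong (_+_ (x % d)) (*-comm d (x / d)) ⟩
  x % d + x / d * d   ≡⟨ sym (m≡m%n+[m/n]*n x d) ⟩
  x                   ∎
  where open ≡-Reasoning

record Split (A B : ℕ → Set) (n : ℕ) : Set where
  constructor split
  field
    a b : ℕ
    a∈A : A a
    b∈B : B b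
    sum : a + b ≡ n

-- A ⊕ B = ⟨N⟩: every n < N has a representation, every sum lies below N,
-- and representations are unique (it suffices to ask that for the A-part).
record Tiling (A B : ℕ → Set) (N : ℕ) : Set where
  field
    nonempty : 0 < N
    cover    : ∀ n → n < N → Split A B n
    bounded  : ∀ {a b} → A a → B b → a + b < N
    unique   : ∀ {a b a' b'} → A a → B b → A a' → B b' → a + b ≡ a' + b' → a ≡ a'

record Symmetric (P : ℕ → Set) : Set where
  field
    top     : ℕ
    top∈    : P top
    ≤top    : ∀ {a} → P a → a ≤ top
    reflect : ∀ {a} → P a → P (top ∸ a)

module TilingFacts {A B : ℕ → Set} {N : ℕ} (T : Tiling A B N) where
  open Tiling T

  private
    split-zero : ∀ {a b} → a + b ≡ 0 → a ≡ 0 × b ≡ 0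
    split-zero {zero} {zero} refl = refl , refl

  0∈A : A 0
  0∈A with cover 0 nonempty
  ... | split a b Aa Bb e = subst A (proj₁ (split-zero e)) Aa

  0∈B : B 0
  0∈B with cover 0 nonempty
  ... | split a b Aa Bb e = subst B (proj₂ (split-zero e)) Bb

  A<N : ∀ {a} → A a → a < N
  A<N {a} Aa = subst (_< N) (+-identityʳ a) (bounded Aa 0∈B)

  B<N : ∀ {b} → B b → b < N
  B<N Bb = bounded 0∈A Bb

  disjoint : ∀ {x} → A x → B x → x ≡ 0
  disjoint {x} Ax Bx = unique Ax 0∈B 0∈A Bx (+-identityʳ x)

  uniqueB : ∀ {a b a' b'} → A a → B b → A a' → B b' → a + b ≡ a' + b' → b ≡ b'
  uniqueB {a} Aa Bb Aa' Bb' e with unique Aa Bb Aa' Bb' e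
  ... | refl = +-cancelˡ-≡ a _ _ e

  A? : ∀ n → Dec (A n)
  A? n with n <? N
  ... | no n≮N = no (n≮N ∘ A<N)
  ... | yes n<N with cover n n<N
  ...   | split a zero Aa _ e = yes (subst A (trans (sym (+-identityʳ a)) e) Aa)
  ...   | split a (suc b) Aa Bb e =
          no λ An → 0≢1+n (uniqueB An 0∈B Aa Bb (trans (+-identityʳ n) (sym e)))

swap : ∀ {A B N} → Tiling A B N → Tiling B A N
swap {A} {B} {N} T = record
  { nonempty = nonempty
  ; cover    = λ n n<N → let split a b Aa Bb e = cover n n<N
                         in split b a Bb Aa (trans (+-comm b a) e)
  ; bounded  = λ {b} {a} Bb Aa → subst (_< N) (+-comm a b) (bounded Aa Bb)
  ; unique   = λ {b} {a} {b'} {a'} Bb Aa Bb' Aa' e →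
                 uniqueB Aa Bb Aa' Bb' (trans (+-comm a b) (trans e (+-comm b' a')))
  }
  where open Tiling T
        open TilingFacts T

block-shift : ∀ d qa qb r → d * qa + r + d * qb ≡ d * (qa + qb) + r
block-shift = solve-∀

digits-∸ : ∀ d {x X r R} → x ≤ X → r ≤ R →
           (d * X + R) ∸ (d * x + r) ≡ d * (X ∸ x) + (R ∸ r)
digits-∸ d {x} {X} {r} {R} x≤X r≤R =
  trans (cong (_∸ (d * x + r)) split-X) (m+n∸m≡n (d * x + r) _)
  where
  regroup : ∀ d u U v V → d * (u + U) + (v + V) ≡ (d * u + v) + (d * U + V)
  regroup = solve-∀
  split-X : d * X + R ≡ (d * x + r) + (d * (X ∸ x) + (R ∸ r))
  split-X = trans (cong₂ (λ u v → d * u + v) (sym (m+[n∸m]≡n x≤X)) (sym (m+[n∸m]≡n r≤R)))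
                  (regroup d x (X ∸ x) r (R ∸ r))

data FirstGap (P : ℕ → Set) (k : ℕ) : Set where
  none : (∀ {n} → n < k → P n) → FirstGap P k
  gap  : ∀ {d} → d < k → ¬ P d → (∀ {n} → n < d → P n) → FirstGap P k

firstGap : ∀ {P : ℕ → Set} → (∀ n → Dec (P n)) → ∀ k → FirstGap P k
firstGap P? zero = none λ ()
firstGap {P} P? (suc k) with firstGap P? k
... | gap d<k ¬Pd below = gap (m<n⇒m<1+n d<k) ¬Pd below
... | none below with P? k
...   | no ¬Pk = gap ≤-refl ¬Pk below
...   | yes Pk = none upto
  where
  upto : ∀ {n} → n < suc k → P n
  upto n<1+k with m<1+n⇒m<n∨m≡n n<1+k
  ... | inj₁ n<k  = below n<k
  ... | inj₂ refl = Pk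

-- de Bruijn's reduction.  Suppose 0, 1, …, d - 1 lie in A but d does not,
-- where d ≥ 2.  Then d ∈ B, every element of B is a multiple of d, whether
-- x lies in A only depends on the block ⌊x / d⌋ of x, and d divides N.
-- Dividing by d therefore turns A ⊕ B = ⟨N⟩ into a tiling of ⟨N / d⟩, and
-- symmetry of the smaller tiling lifts back to A and B.
module Reduction {A B : ℕ → Set} {N : ℕ} (T : Tiling A B N) (d₂ : ℕ)
  (d<N : suc (suc d₂) < N) (d∉A : ¬ A (suc (suc d₂)))
  (below-d : ∀ {n} → n < suc (suc d₂) → A n) where

  open Tiling T
  open TilingFacts T

  d₁ d : ℕ
  d₁ = suc d₂
  d  = suc d₁

  d∈B : B d
  d∈B with cover d d<N
  ... | split a zero Aa _ e = ⊥-elim (d∉A (subst A (trans (sym (+-identityʳ a)) e) Aa))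
  ... | split a (suc b) Aa Bb e with m≤n⇒m<n∨m≡n (subst (suc b ≤_) e (m≤n+m (suc b) a))
  ...   | inj₁ b<d  = ⊥-elim (1+n≢0 (disjoint (below-d b<d) Bb))
  ...   | inj₂ refl = Bb

  record Block (q r : ℕ) : Set where
    field
      aligned : B (d * q + r) → r ≡ 0
      fill    : A (d * q) → A (d * q + r)
      head    : A (d * q + r) → A (d * q)

  BlocksBelow : ℕ → Set
  BlocksBelow n = ∀ q r → r < d → d * q + r < n → Block q r

  record Decomposed (Q R : ℕ) : Set where
    constructor decomposed
    field
      qa qb    : ℕ
      blocks   : qa + qb ≡ Q
      head∈A   : A (d * qa)
      a∈A      : A (d * qa + R)
      b∈B      : B (d * qb)

  decompose : ∀ {n Q R} → BlocksBelow n → R < d → (s : Split A B (d * Q + R)) →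
              Split.a s < n → Split.b s < n → Decomposed Q R
  decompose {n} {Q} {R} ih R<d (split a b Aa Bb e) a<n b<n =
    decomposed (a / d) (b / d) (proj₁ same-digits) head∈A
      (subst A (trans (sym (div-mod d a)) (cong (_+_ (d * (a / d))) (proj₂ same-digits))) Aa)
      (subst B (sym b-multiple) Bb)
    where
    below : ∀ x → x < n → d * (x / d) + x % d < n
    below x x<n = subst (_< n) (sym (div-mod d x)) x<n
    b-multiple : d * (b / d) ≡ b
    b-multiple = trans (sym (+-identityʳ _))
      (trans (cong (_+_ (d * (b / d))) (sym (Block.aligned (ih (b / d) (b % d) (m%n<n b d) (below b b<n))
                                                       (subst B (sym (div-mod d b)) Bb))))
             (div-mod d b))
    head∈A : A (d * (a / d))
    head∈A = Block.head (ih (a / d) (a % d) (m%n<n a d) (below a a<n)) (subst A (sym (div-mod d a)) Aa)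
    same-digits : a / d + b / d ≡ Q × a % d ≡ R
    same-digits = digits-unique d (m%n<n a d) R<d (begin
      d * (a / d + b / d) + a % d     ≡⟨ sym (block-shift d (a / d) (b / d) (a % d)) ⟩
      d * (a / d) + a % d + d * (b / d) ≡⟨ cong₂ _+_ (div-mod d a) b-multiple ⟩
      a + b                          ≡⟨ e ⟩
      d * Q + R                      ∎)
      where open ≡-Reasoning

  position-0 : ∀ q → Block q 0
  position-0 q = record
    { aligned = λ _ → refl
    ; fill    = subst A (sym (+-identityʳ (d * q)))
    ; head    = subst A (+-identityʳ (d * q))
    }

  -- Block 0 is ⟨d⟩ ⊆ A, so it meets B only in 0.
  block-0 : ∀ r₀ → suc r₀ < d → Block 0 (suc r₀)
  block-0 r₀ r<d = record
    { aligned = λ Bn → ⊥-elim (m+1+n≢0 (d * 0) (disjoint n∈A Bn))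
    ; fill    = λ _ → n∈A
    ; head    = λ _ → subst A (sym (*-zeroʳ d)) 0∈A
    }
    where
    n∈A : A (d * 0 + suc r₀)
    n∈A = subst A (cong (_+ suc r₀) (sym (*-zeroʳ d))) (below-d r<d)

  -- The inductive step for n = d * q + (r₀ + 1) with q ≥ 1, looking at the
  -- representation of its predecessor p = d * q + r₀.
  module LaterBlock (q₀ r₀ : ℕ) (r<d : suc r₀ < d) (n<N : d * suc q₀ + suc r₀ < N)
                    (ih : BlocksBelow (d * suc q₀ + suc r₀)) where
    q n p : ℕ
    q = suc q₀
    n = d * q + suc r₀
    p = d * q + r₀

    r₀<d : r₀ < d
    r₀<d = <-trans (n<1+n r₀) r<d

    p<n : p < n
    p<n = +-monoʳ-< (d * q) (n<1+n r₀)

    fill : ∀ q' r → r < d → d * q' + r < n → A (d * q') → A (d * q' + r)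
    fill q' r r<d lt = Block.fill (ih q' r r<d lt)

    earlier : ∀ {qa k r} → qa + suc k ≡ q → r < d → d * qa + r < n
    earlier {qa} e r<d = block-< d r<d (subst (qa <_) e (m<m+n qa z<s))

    summands-below : ∀ {x} (s : Split A B x) → x < n → Split.a s < n × Split.b s < n
    summands-below (split a b _ _ e) x<n =
      ≤-<-trans (subst (a ≤_) e (m≤m+n a b)) x<n , ≤-<-trans (subst (b ≤_) e (m≤n+m b a)) x<n

    p-decomposed : Decomposed q r₀
    p-decomposed with cover p (<-trans p<n n<N)
    ... | s = decompose ih r₀<d s (proj₁ (summands-below s p<n)) (proj₂ (summands-below s p<n))

    -- If p's B-part lies in a positive block qb = k + 1, so does n's:
    -- n = x + d * qb with 0 ≠ x ∈ A, which excludes n from both A and B.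
    module Carry {qa k} (e : qa + suc k ≡ q) (Aqa : A (d * qa)) (Bqb : B (d * suc k)) where
      x : ℕ
      x = d * qa + suc r₀
      x∈A : A x
      x∈A = fill qa (suc r₀) r<d (earlier e r<d) Aqa
      x+b : x + d * suc k ≡ n
      x+b = trans (block-shift d qa (suc k) (suc r₀)) (cong (λ z → d * z + suc r₀) e)
      n∉B : ¬ B n
      n∉B Bn = m+1+n≢0 (d * qa) (unique x∈A Bqb 0∈A Bn x+b)
      n∉A : ¬ A n
      n∉A An with uniqueB x∈A Bqb An 0∈B (trans x+b (sym (+-identityʳ n)))
      ... | ()

    -- n ∉ B: if p's B-part lies in block 0, then d * q ∈ A and with
    -- t = d - (r₀ + 1) ∈ A the number t + n = d * q + d has two representations.
    n∉B : ¬ B n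
    n∉B with p-decomposed
    ... | decomposed qa (suc k) e Aqa _ Bqb = Carry.n∉B e Aqa Bqb
    ... | decomposed qa zero e Aqa _ _ = λ Bn → <⇒≢ t<dq (unique t∈A Bn dq∈A d∈B t+n)
      where
      open ≡-Reasoning
      t : ℕ
      t = d ∸ suc r₀
      t∈A : A t
      t∈A = below-d (s≤s (m∸n≤m d₁ r₀))
      t<dq : t < d * q
      t<dq = <-≤-trans (s≤s (m∸n≤m d₁ r₀)) (subst (d ≤_) (sym (*-suc d q₀)) (m≤m+n d (d * q₀)))
      dq∈A : A (d * q)
      dq∈A = subst (λ z → A (d * z)) (trans (sym (+-identityʳ qa)) e) Aqa
      t+n : t + n ≡ d * q + d
      t+n = begin
        t + (d * q + suc r₀) ≡⟨ +-comm t (d * q + suc r₀) ⟩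
        d * q + suc r₀ + t   ≡⟨ +-assoc (d * q) (suc r₀) t ⟩
        d * q + (suc r₀ + t) ≡⟨ cong (_+_ (d * q)) (m+[n∸m]≡n (<⇒≤ r<d)) ⟩
        d * q + d            ∎

    -- If n ∈ A, then p's B-part lies in block 0 and p's A-part has head d * q.
    n∈A⇒dq∈A : A n → A (d * q)
    n∈A⇒dq∈A An with p-decomposed
    ... | decomposed qa (suc k) e Aqa _ Bqb = ⊥-elim (Carry.n∉A e Aqa Bqb An)
    ... | decomposed qa zero e Aqa _ _ = subst (λ z → A (d * z)) (trans (sym (+-identityʳ qa)) e) Aqa

    -- Conversely split n itself; its B-part cannot lie in a positive block,
    -- for then p would have a second representation.
    dq∈A⇒n∈A : A (d * q) → A n
    dq∈A⇒n∈A dq∈A with cover n n<N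
    ... | s@(split a b Aa Bb e) with m≤n⇒m<n∨m≡n (subst (a ≤_) e (m≤m+n a b))
                                   | m≤n⇒m<n∨m≡n (subst (b ≤_) e (m≤n+m b a))
    ... | inj₂ a≡n | _        = subst A a≡n Aa
    ... | inj₁ _   | inj₂ b≡n = ⊥-elim (n∉B (subst B b≡n Bb))
    ... | inj₁ a<n | inj₁ b<n with decompose ih r<d s a<n b<n
    ...   | decomposed qa zero e' _ a∈A _ =
            subst (λ z → A (d * z + suc r₀)) (trans (sym (+-identityʳ qa)) e') a∈A
    ...   | decomposed qa (suc k) e' Aqa _ Bqb
            with uniqueB (fill qa r₀ r₀<d (earlier e' r₀<d) Aqa) Bqb
                         (fill q r₀ r₀<d p<n dq∈A) 0∈B
                         (trans (block-shift d qa (suc k) r₀)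
                                (trans (cong (λ z → d * z + r₀) e') (sym (+-identityʳ p))))
    ...     | ()

    result : Block q (suc r₀)
    result = record { aligned = ⊥-elim ∘ n∉B ; fill = dq∈A⇒n∈A ; head = n∈A⇒dq∈A }

  block : ∀ q r → r < d → d * q + r < N → Block q r
  block q r r<d = <-rec Below step (d * q + r) q r r<d refl
    where
    Below : ℕ → Set
    Below n = ∀ q r → r < d → d * q + r ≡ n → n < N → Block q r
    step : ∀ n → (∀ {m} → m < n → Below m) → Below n
    step n rec q zero _ _ _ = position-0 q
    step n rec zero (suc r₀) r<d _ _ = block-0 r₀ r<d
    step n rec (suc q₀) (suc r₀) r<d refl n<N =
      LaterBlock.result q₀ r₀ r<d n<N (λ q' r' r'<d lt → rec lt q' r' r'<d refl (<-trans lt n<N))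

  block-of : ∀ {x} → x < N → Block (x / d) (x % d)
  block-of {x} x<N = block (x / d) (x % d) (m%n<n x d) (subst (_< N) (sym (div-mod d x)) x<N)

  B-multiple : ∀ {x} → B x → d * (x / d) ≡ x
  B-multiple {x} Bx = trans (sym (+-identityʳ _))
    (trans (cong (_+_ (d * (x / d))) (sym (Block.aligned (block-of (B<N Bx)) (subst B (sym (div-mod d x)) Bx))))
           (div-mod d x))

  A-head : ∀ {x} → A x → A (d * (x / d))
  A-head {x} Ax = Block.head (block-of (A<N Ax)) (subst A (sym (div-mod d x)) Ax)

  A-fill : ∀ q r → r < d → d * q + r < N → A (d * q) → A (d * q + r)
  A-fill q r r<d lt = Block.fill (block q r r<d lt)

  -- d divides N: the largest number N - 1 = a + b sits at the last
  -- position d - 1 of its block, since d * ⌊a/d⌋ + (d - 1) ∈ A and a + b is maximal.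
  private
    N' : ℕ
    N' = pred N
    N'+1 : suc N' ≡ N
    N'+1 = suc-pred N {{>-nonZero nonempty}}
    module Top = Split (cover N' (subst (N' <_) N'+1 ≤-refl))

    z : ℕ
    z = d * (Top.a / d) + d₁
    z<N : z < N
    z<N = <-trans (+-monoʳ-< (d * (Top.a / d)) (n<1+n d₁)) (bounded (A-head Top.a∈A) d∈B)
    last-position : Top.a % d ≡ d₁
    last-position = ≤-antisym (s≤s⁻¹ (m%n<n Top.a d)) (+-cancelˡ-≤ (d * (Top.a / d)) _ _ z≤a)
      where
      z+b<N : z + Top.b < N
      z+b<N = bounded (A-fill (Top.a / d) d₁ (n<1+n d₁) z<N (A-head Top.a∈A)) Top.b∈B
      z≤a : z ≤ d * (Top.a / d) + Top.a % d
      z≤a = subst (z ≤_) (sym (div-mod d Top.a))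
              (+-cancelʳ-≤ Top.b z Top.a (s≤s⁻¹ (subst (z + Top.b <_) (trans (sym N'+1) (cong suc (sym Top.sum))) z+b<N)))

  N₁ : ℕ
  N₁ = suc (Top.a / d + Top.b / d)

  N≡dN₁ : N ≡ d * N₁
  N≡dN₁ = begin
    N                                                  ≡⟨ sym N'+1 ⟩
    suc N'                                             ≡⟨ cong suc (sym Top.sum) ⟩
    suc (Top.a + Top.b)                                ≡⟨ cong suc (cong₂ _+_ (sym (div-mod d Top.a)) (sym (B-multiple Top.b∈B))) ⟩
    suc (d * (Top.a / d) + Top.a % d + d * (Top.b / d)) ≡⟨ cong (λ r → suc (d * (Top.a / d) + r + d * (Top.b / d))) last-position ⟩
    suc (d * (Top.a / d) + d₁ + d * (Top.b / d))       ≡⟨ close-block d₁ (Top.a / d) (Top.b / d) ⟩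
    d * N₁                                             ∎
    where
    open ≡-Reasoning
    close-block : ∀ d₁ x y → suc (suc d₁ * x + d₁ + suc d₁ * y) ≡ suc d₁ * suc (x + y)
    close-block = solve-∀

  A₁ B₁ : ℕ → Set
  A₁ q = A (d * q)
  B₁ q = B (d * q)

  N₁<N : N₁ < N
  N₁<N = subst (N₁ <_) (trans (*-comm N₁ d) (sym N≡dN₁)) (m<m*n N₁ d (s≤s (s≤s z≤n)))

  divided : Tiling A₁ B₁ N₁
  divided = record
    { nonempty = z<s
    ; cover    = cover₁
    ; bounded  = λ {a} {b} Aa Bb → *-cancelˡ-< d (a + b) N₁
                   (subst₂ _<_ (sym (*-distribˡ-+ d a b)) N≡dN₁ (bounded Aa Bb))
    ; unique   = λ {a} {b} {a'} {b'} Aa Bb Aa' Bb' e → *-cancelˡ-≡ a a' d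
                   (unique Aa Bb Aa' Bb' (trans (sym (*-distribˡ-+ d a b))
                                         (trans (cong (d *_) e) (*-distribˡ-+ d a' b'))))
    }
    where
    cover₁ : ∀ k → k < N₁ → Split A₁ B₁ k
    cover₁ k k<N₁ with cover (d * k) (subst (d * k <_) (sym N≡dN₁) (*-monoʳ-< d k<N₁))
    ... | split a b Aa Bb e =
          split (a / d) (b / d) (A-head Aa) (subst B (sym (B-multiple Bb)) Bb)
                (proj₁ (digits-unique d (m%n<n a d) z<s digits))
      where
      open ≡-Reasoning
      digits : d * (a / d + b / d) + a % d ≡ d * k + 0
      digits = begin
        d * (a / d + b / d) + a % d       ≡⟨ sym (block-shift d (a / d) (b / d) (a % d)) ⟩
        d * (a / d) + a % d + d * (b / d) ≡⟨ cong₂ _+_ (div-mod d a) (B-multiple Bb) ⟩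
        a + b                             ≡⟨ e ⟩
        d * k                             ≡⟨ sym (+-identityʳ (d * k)) ⟩
        d * k + 0                         ∎

  -- Symmetry of A₁ and B₁ lifts: A = ⟨d⟩ ⊕ d·A₁ and B = d·B₁.
  lift : Symmetric A₁ × Symmetric B₁ → Symmetric A × Symmetric B
  lift (SA₁ , SB₁) = symmetric-A , symmetric-B
    where
    module SA₁ = Symmetric SA₁
    module SB₁ = Symmetric SB₁
    M₁ M : ℕ
    M₁ = SA₁.top
    M  = d * M₁ + d₁
    M<N : M < N
    M<N = subst (M <_) (trans (+-identityʳ (d * N₁)) (sym N≡dN₁))
            (block-< d (n<1+n d₁) (*-cancelˡ-< d M₁ N₁ (subst (d * M₁ <_) N≡dN₁ (A<N SA₁.top∈))))
    symmetric-A : Symmetric A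
    symmetric-A = record
      { top     = M
      ; top∈    = A-fill M₁ d₁ (n<1+n d₁) M<N SA₁.top∈
      ; ≤top    = λ {a} Aa → subst (_≤ M) (div-mod d a)
                     (+-mono-≤ (*-monoʳ-≤ d (SA₁.≤top {a / d} (A-head Aa))) (s≤s⁻¹ (m%n<n a d)))
      ; reflect = reflect
      }
      where
      reflect : ∀ {a} → A a → A (M ∸ a)
      reflect {a} Aa = subst A (sym M-a) (A-fill (M₁ ∸ a / d) (d₁ ∸ a % d) (s≤s (m∸n≤m d₁ (a % d)))
                         (subst (_< N) M-a (≤-<-trans (m∸n≤m M a) M<N)) (SA₁.reflect {a / d} (A-head Aa)))
        where
        M-a : M ∸ a ≡ d * (M₁ ∸ a / d) + (d₁ ∸ a % d)
        M-a = trans (cong (M ∸_) (sym (div-mod d a)))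
                    (digits-∸ d (SA₁.≤top {a / d} (A-head Aa)) (s≤s⁻¹ (m%n<n a d)))
    symmetric-B : Symmetric B
    symmetric-B = record
      { top     = d * SB₁.top
      ; top∈    = SB₁.top∈
      ; ≤top    = λ {b} Bb → subst (_≤ d * SB₁.top) (B-multiple Bb) (*-monoʳ-≤ d (SB₁.≤top {b / d} (in-B₁ Bb)))
      ; reflect = λ {b} Bb → subst B (trans (*-distribˡ-∸ d SB₁.top (b / d)) (cong (d * SB₁.top ∸_) (B-multiple Bb)))
                                    (SB₁.reflect {b / d} (in-B₁ Bb))
      }
      where
      in-B₁ : ∀ {b} → B b → B₁ (b / d)
      in-B₁ Bb = subst B (sym (B-multiple Bb)) Bb

full-tiling : ∀ {A B N} → Tiling A B N → (∀ {n} → n < N → A n) → Symmetric A × Symmetric B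
full-tiling {A} {B} {N} T all = symmetric-A , symmetric-B
  where
  open Tiling T
  open TilingFacts T
  N-1<N : pred N < N
  N-1<N = subst (pred N <_) (suc-pred N {{>-nonZero nonempty}}) ≤-refl
  symmetric-A : Symmetric A
  symmetric-A = record
    { top     = pred N
    ; top∈    = all N-1<N
    ; ≤top    = <⇒≤pred ∘ A<N
    ; reflect = λ {a} _ → all (≤-<-trans (m∸n≤m (pred N) a) N-1<N)
    }
  only-0 : ∀ {b} → B b → b ≡ 0
  only-0 Bb = disjoint (all (B<N Bb)) Bb
  symmetric-B : Symmetric B
  symmetric-B = record
    { top     = 0
    ; top∈    = 0∈B
    ; ≤top    = ≤-reflexive ∘ only-0
    ; reflect = λ {b} _ → subst B (sym (0∸n≡0 b)) 0∈B
    }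

SymmetricBelow : ℕ → Set₁
SymmetricBelow N = ∀ {A B N'} → N' < N → Tiling A B N' → Symmetric A × Symmetric B

1∈B : ∀ {A B N} → Tiling A B N → 1 < N → ¬ A 1 → B 1
1∈B {A} {B} T 1<N 1∉A with Tiling.cover T 1 1<N
... | split zero b _ Bb e = subst B e Bb
... | split (suc zero) zero Aa _ _ = ⊥-elim (1∉A Aa)

-- Look at the least number outside A: if there is none the tiling is
-- trivial, if it is 1 then 1 ∈ B, otherwise de Bruijn's reduction applies.
reduce-or-1∈B : ∀ {A B N} → SymmetricBelow N → Tiling A B N → B 1 ⊎ (Symmetric A × Symmetric B)
reduce-or-1∈B {A} {B} {N} ih T with firstGap (TilingFacts.A? T) N
... | none all = inj₂ (full-tiling T all)
... | gap {zero} _ 0∉A _ = ⊥-elim (0∉A (TilingFacts.0∈A T))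
... | gap {suc zero} 1<N 1∉A _ = inj₁ (1∈B T 1<N 1∉A)
... | gap {suc (suc d₂)} d<N d∉A below =
      inj₂ (lift (ih N₁<N divided))
  where open Reduction T d₂ d<N d∉A below

tiling-symmetric : ∀ {A B N} → Tiling A B N → Symmetric A × Symmetric B
tiling-symmetric {N = N} = <-rec Goal step N
  where
  Goal : ℕ → Set₁
  Goal N = ∀ {A B} → Tiling A B N → Symmetric A × Symmetric B
  step : ∀ N → (∀ {N'} → N' < N → Goal N') → Goal N
  step N rec T with reduce-or-1∈B (λ lt → rec lt) T
  ... | inj₂ symmetric = symmetric
  ... | inj₁ B1 with reduce-or-1∈B (λ lt → rec lt) (swap T)
  ...   | inj₂ (symmetric-B , symmetric-A) = symmetric-A , symmetric-B
  ...   | inj₁ A1 = ⊥-elim (1+n≢0 (TilingFacts.disjoint T A1 B1))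

Σℕ : ∀ {m} → (Fin m → ℕ) → ℕ
Σℕ = sumF _+_ 0

sumF-cong : ∀ {X : Set} (_⊕_ : X → X → X) e {m} {f g : Fin m → X} →
            (∀ j → f j ≡ g j) → sumF _⊕_ e f ≡ sumF _⊕_ e g
sumF-cong _⊕_ e {zero}  f≗g = refl
sumF-cong _⊕_ e {suc m} f≗g = cong₂ _⊕_ (f≗g zero) (sumF-cong _⊕_ e (f≗g ∘ suc))

Σℕ-mono : ∀ {m} {f g : Fin m → ℕ} → (∀ j → f j ≤ g j) → Σℕ f ≤ Σℕ g
Σℕ-mono {zero}  f≤g = z≤n
Σℕ-mono {suc m} f≤g = +-mono-≤ (f≤g zero) (Σℕ-mono (f≤g ∘ suc))

Σℕ≡0 : ∀ {m} (f : Fin m → ℕ) → Σℕ f ≡ 0 → ∀ j → f j ≡ 0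
Σℕ≡0 f e zero    = m+n≡0⇒m≡0 (f zero) e
Σℕ≡0 f e (suc j) = Σℕ≡0 (f ∘ suc) (m+n≡0⇒n≡0 (f zero) e) j

_[_]≔_ : ∀ {X : Set} {m} → (Fin m → X) → Fin m → X → Fin m → X
f [ j ]≔ v = updateAt f j (const v)

module _ {ℓ} (CM : CommutativeMonoid 0ℓ ℓ) where
  open CommutativeMonoid CM using (Carrier; _≈_; _∙_; ε; assoc; comm; ∙-congˡ; ∙-congʳ) renaming (sym to ≈-sym)
  open ≈-Reasoning (CommutativeMonoid.setoid CM)

  sumF-≔ : ∀ {m} (f : Fin m → Carrier) j v → sumF _∙_ ε (f [ j ]≔ v) ∙ f j ≈ v ∙ sumF _∙_ ε f
  sumF-≔ f zero v = begin
    (v ∙ rest) ∙ f zero ≈⟨ assoc v rest (f zero) ⟩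
    v ∙ (rest ∙ f zero) ≈⟨ ∙-congˡ (comm rest (f zero)) ⟩
    v ∙ (f zero ∙ rest) ∎
    where rest = sumF _∙_ ε (f ∘ suc)
  sumF-≔ f (suc j) v = begin
    (f zero ∙ rest′) ∙ f (suc j) ≈⟨ assoc (f zero) rest′ (f (suc j)) ⟩
    f zero ∙ (rest′ ∙ f (suc j)) ≈⟨ ∙-congˡ (sumF-≔ (f ∘ suc) j v) ⟩
    f zero ∙ (v ∙ rest)          ≈⟨ ≈-sym (assoc (f zero) v rest) ⟩
    (f zero ∙ v) ∙ rest          ≈⟨ ∙-congʳ (comm (f zero) v) ⟩
    (v ∙ f zero) ∙ rest          ≈⟨ assoc v (f zero) rest ⟩
    v ∙ (f zero ∙ rest)          ∎
    where rest  = sumF _∙_ ε (f ∘ suc)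
          rest′ = sumF _∙_ ε ((f ∘ suc) [ j ]≔ v)

≔-∈ : ∀ {X : Set} {m} {T : Fin m → List X} {f : Fin m → X} {v} j →
      (∀ k → f k ∈ T k) → v ∈ T j → ∀ k → (f [ j ]≔ v) k ∈ T k
≔-∈ {T = T} {f} {v} j f∈T v∈Tj k with k ≟ᶠ j
... | yes refl = subst (_∈ T k) (sym (updateAt-updates k f)) v∈Tj
... | no k≢j   = subst (_∈ T k) (sym (updateAt-minimal k j f k≢j)) (f∈T k)

dedup : List ℕ → List ℕ
dedup = deduplicate _≟_

same-length : {xs ys : List ℕ} → Unique xs → Unique ys → (∀ {x} → x ∈ xs ⇔ x ∈ ys) →
              length xs ≡ length ys
same-length xs! ys! xs⇔ys = ↭-length (∼bag⇒↭ (unique∧set⇒bag xs! ys! xs⇔ys))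

cardℕ-unique : ∀ {xs} → Unique xs → cardℕ xs ≡ length xs
cardℕ-unique {xs} xs! = same-length (deduplicate-! xs) xs! (mk⇔ (∈-deduplicate⁻ _≟_ xs) (∈-deduplicate⁺ _≟_))

dedup-full⇒unique : ∀ xs → length (dedup xs) ≡ length xs → Unique xs
dedup-full⇒unique []       _ = []
dedup-full⇒unique (x ∷ xs) e = All.tabulate x∉xs ∷ dedup-full⇒unique xs rest-full
  where
  x≢? = ¬? ∘ (x ≟_)
  kept : length (filter x≢? (dedup xs)) ≡ length xs
  kept = suc-injective e
  rest-full : length (dedup xs) ≡ length xs
  rest-full = ≤-antisym (length-deduplicate _≟_ xs)
                        (subst (_≤ length (dedup xs)) kept (length-filter x≢? (dedup xs)))
  filter-id : filter x≢? (dedup xs) ≡ dedup xs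
  filter-id = filter-complete x≢? (trans kept (sym rest-full))
  x∉xs : ∀ {y} → y ∈ xs → x ≢ y
  x∉xs y∈xs = proj₂ (∈-filter⁻ x≢? {xs = dedup xs}
                       (subst (_ ∈_) (sym filter-id) (∈-deduplicate⁺ _≟_ y∈xs)))

covering-unique : ∀ xs {S} → Unique S → (∀ {x} → x ∈ S → x ∈ xs) → length xs ≤ length S → Unique xs
covering-unique xs {S} S! S⊆xs short =
  dedup-full⇒unique xs (≤-antisym (length-deduplicate _≟_ xs)
    (≤-trans short (≤-trans (≤-reflexive (sym S-length)) (length-filter (_∈? S) (dedup xs)))))
  where
  S-length : length (filter (_∈? S) (dedup xs)) ≡ length S
  S-length = same-length (Unique.filter⁺ (_∈? S) (deduplicate-! xs)) S!
    (mk⇔ (λ p → proj₂ (∈-filter⁻ (_∈? S) {xs = dedup xs} p))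
         (λ p → ∈-filter⁺ (_∈? S) (∈-deduplicate⁺ _≟_ (S⊆xs p)) p))

Unique-++⁻ : ∀ {X : Set} (xs : List X) {ys} → Unique (xs ++ ys) →
             Unique xs × Unique ys × (∀ {x y} → x ∈ xs → y ∈ ys → x ≢ y)
Unique-++⁻ []       xs++ys! = [] , xs++ys! , λ ()
Unique-++⁻ (x ∷ xs) (x∉ ∷ xs++ys!) with Unique-++⁻ xs xs++ys!
... | xs! , ys! , apart = All.++⁻ˡ xs x∉ ∷ xs! , ys! , apart′
  where
  apart′ : ∀ {u v} → u ∈ x ∷ xs → v ∈ _ → u ≢ v
  apart′ (here refl) v∈ys = All.lookup (All.++⁻ʳ xs x∉) v∈ys
  apart′ (there u∈xs) v∈ys = apart u∈xs v∈ys

module Blocks {X Y : Set} (g : X → List Y) where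

  block-unique : ∀ {D x} → Unique (concatMap g D) → x ∈ D → Unique (g x)
  block-unique {d ∷ D} gD! (here refl) = proj₁ (Unique-++⁻ (g d) gD!)
  block-unique {d ∷ D} gD! (there x∈D) = block-unique (proj₁ (proj₂ (Unique-++⁻ (g d) gD!))) x∈D

  same-block : ∀ {D x x' y} → Unique (concatMap g D) → x ∈ D → x' ∈ D →
               y ∈ g x → y ∈ g x' → x ≡ x'
  same-block {d ∷ D} gD! (here refl) (here refl) _ _ = refl
  same-block {d ∷ D} gD! (here refl) (there x'∈D) y∈ y∈' =
    ⊥-elim (proj₂ (proj₂ (Unique-++⁻ (g d) gD!)) y∈ (∈-concat⁺′ y∈' (∈-map⁺ g x'∈D)) refl)
  same-block {d ∷ D} gD! (there x∈D) (here refl) y∈ y∈' =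
    ⊥-elim (proj₂ (proj₂ (Unique-++⁻ (g d) gD!)) y∈' (∈-concat⁺′ y∈ (∈-map⁺ g x∈D)) refl)
  same-block {d ∷ D} gD! (there x∈D) (there x'∈D) y∈ y∈' =
    same-block (proj₁ (proj₂ (Unique-++⁻ (g d) gD!))) x∈D x'∈D y∈ y∈'

tuple-sums : ∀ {m} → (Fin m → List ℕ) → List ℕ
tuple-sums {zero}  T = 0 ∷ []
tuple-sums {suc m} T = concatMap (λ x → map (_+_ x) (tuple-sums (T ∘ suc))) (dedup (T zero))

length-tuple-sums : ∀ {m} (T : Fin m → List ℕ) → length (tuple-sums T) ≡ prodℕ (λ j → cardℕ (T j))
length-tuple-sums {zero}  T = refl
length-tuple-sums {suc m} T =
  trans (length-blocks (dedup (T zero))) (cong (cardℕ (T zero) *_) (length-tuple-sums (T ∘ suc)))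
  where
  L = tuple-sums (T ∘ suc)
  length-blocks : ∀ D → length (concatMap (λ x → map (_+_ x) L) D) ≡ length D * length L
  length-blocks []      = refl
  length-blocks (x ∷ D) = trans (length-++ (map (_+_ x) L)) (cong₂ _+_ (length-map (_+_ x) L) (length-blocks D))

∈-tuple-sums : ∀ {m} (T : Fin m → List ℕ) {f : Fin m → ℕ} → (∀ j → f j ∈ T j) → Σℕ f ∈ tuple-sums T
∈-tuple-sums {zero}  T f∈T = here refl
∈-tuple-sums {suc m} T {f} f∈T =
  ∈-concat⁺′ (∈-map⁺ (_+_ (f zero)) (∈-tuple-sums (T ∘ suc) (f∈T ∘ suc)))
             (∈-map⁺ (λ x → map (_+_ x) (tuple-sums (T ∘ suc))) (∈-deduplicate⁺ _≟_ (f∈T zero)))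

tuple-sums-injective : ∀ {m} (T : Fin m → List ℕ) → Unique (tuple-sums T) →
  ∀ {f g} → (∀ j → f j ∈ T j) → (∀ j → g j ∈ T j) → Σℕ f ≡ Σℕ g → ∀ j → f j ≡ g j
tuple-sums-injective {suc m} T sums! {f} {g} f∈T g∈T e = components
  where
  L = tuple-sums (T ∘ suc)
  open Blocks (λ x → map (_+_ x) L)
  f₀∈ = ∈-deduplicate⁺ _≟_ (f∈T zero)
  first : f zero ≡ g zero
  first = same-block sums! f₀∈ (∈-deduplicate⁺ _≟_ (g∈T zero))
            (∈-map⁺ (_+_ (f zero)) (∈-tuple-sums (T ∘ suc) (f∈T ∘ suc)))
            (subst (_∈ map (_+_ (g zero)) L) (sym e) (∈-map⁺ (_+_ (g zero)) (∈-tuple-sums (T ∘ suc) (g∈T ∘ suc))))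
  rest : Σℕ (f ∘ suc) ≡ Σℕ (g ∘ suc)
  rest = +-cancelˡ-≡ (f zero) _ _ (trans e (cong (_+ Σℕ (g ∘ suc)) (sym first)))
  components : ∀ j → f j ≡ g j
  components zero    = first
  components (suc j) = tuple-sums-injective (T ∘ suc) (Unique.map⁻ (block-unique sums! f₀∈))
                         (f∈T ∘ suc) (g∈T ∘ suc) rest j

prodℕ-pos : ∀ {m} (f : Fin m → ℕ) → (∀ j → 0 < f j) → 0 < prodℕ f
prodℕ-pos {zero}  f f>0 = z<s
prodℕ-pos {suc m} f f>0 = *-mono-< (f>0 zero) (prodℕ-pos (f ∘ suc) (f>0 ∘ suc))

prodℕ-cong : ∀ {m} {f g : Fin m → ℕ} → (∀ j → f j ≡ g j) → prodℕ f ≡ prodℕ g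
prodℕ-cong {zero}  f≗g = refl
prodℕ-cong {suc m} f≗g = cong₂ _*_ (f≗g zero) (prodℕ-cong (f≗g ∘ suc))

prodℕ-double : ∀ {m} (f : Fin m → ℕ) → prodℕ (λ j → f j + f j) ≡ 2 ^ m * prodℕ f
prodℕ-double {zero}  f = refl
prodℕ-double {suc m} f =
  trans (cong ((f zero + f zero) *_) (prodℕ-double (f ∘ suc))) (regroup (2 ^ m) (f zero) (prodℕ (f ∘ suc)))
  where
  regroup : ∀ a b c → (b + b) * (a * c) ≡ 2 * a * (b * c)
  regroup = solve-∀

-- In a sum system T₁ + ⋯ + Tₘ = ⟨P⟩ there are exactly P tuples, so every
-- n < P has a unique representation.  Hence each Tⱼ tiles ⟨P⟩ together
-- with the sums of the other components, and is therefore symmetric.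
module SumSystemFacts {m} (T : Fin m → List ℕ) (sys : SumSystem T) where

  P : ℕ
  P = prodℕ (λ j → cardℕ (T j))

  sum<P : ∀ {f} → (∀ j → f j ∈ T j) → Σℕ f < P
  sum<P {f} f∈T = Equivalence.to (proj₂ sys (Σℕ f)) (f , f∈T , refl)

  realise : ∀ {n} → n < P → InSumset _+_ 0 T n
  realise {n} = Equivalence.from (proj₂ sys n)

  0<P : 0 < P
  0<P = prodℕ-pos _ (λ j → <-trans z<s (proj₁ sys j))

  representation-unique : ∀ {f g} → (∀ j → f j ∈ T j) → (∀ j → g j ∈ T j) →
                          Σℕ f ≡ Σℕ g → ∀ j → f j ≡ g j
  representation-unique = tuple-sums-injective T
    (covering-unique (tuple-sums T) (Unique.upTo⁺ P)
      (λ n∈⟨P⟩ → let (f , f∈T , n≡) = realise (∈-upTo⁻ n∈⟨P⟩)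
                 in subst (_∈ tuple-sums T) (sym n≡) (∈-tuple-sums T f∈T))
      (≤-reflexive (trans (length-tuple-sums T) (sym (length-upTo P)))))

  0∈T : ∀ j → 0 ∈ T j
  0∈T j with realise 0<P
  ... | f , f∈T , 0≡ = subst (_∈ T j) (Σℕ≡0 f (sym 0≡) j) (f∈T j)

  Others : Fin m → ℕ → Set
  Others j r = Σ (Fin m → ℕ) λ g → (∀ k → g k ∈ T k) × g j ≡ 0 × r ≡ Σℕ g

  private
    insert : ∀ (j : Fin m) a (g : Fin m → ℕ) → g j ≡ 0 → a + Σℕ g ≡ Σℕ (g [ j ]≔ a)
    insert j a g gj≡0 = sym (trans (sym (+-identityʳ _))
      (trans (cong (_+_ (Σℕ (g [ j ]≔ a))) (sym gj≡0)) (sumF-≔ +-0-commutativeMonoid g j a)))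

  component-tiling : ∀ j → Tiling (_∈ T j) (Others j) P
  component-tiling j = record
    { nonempty = 0<P
    ; cover    = λ n n<P → let (f , f∈T , n≡) = realise n<P in
        split (f j) (Σℕ (f [ j ]≔ 0)) (f∈T j)
              (f [ j ]≔ 0 , ≔-∈ j f∈T (0∈T j) , updateAt-updates j f , refl)
              (trans (trans (+-comm (f j) _) (sumF-≔ +-0-commutativeMonoid f j 0)) (sym n≡))
    ; bounded  = λ { {a} a∈Tj (g , g∈T , gj≡0 , refl) →
        subst (_< P) (sym (insert j a g gj≡0)) (sum<P (≔-∈ j g∈T a∈Tj)) }
    ; unique   = λ { {a} {_} {a'} a∈Tj (g , g∈T , gj≡0 , refl) a'∈Tj (g' , g'∈T , g'j≡0 , refl) e →
        trans (sym (updateAt-updates j g))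
          (trans (representation-unique (≔-∈ j g∈T a∈Tj) (≔-∈ j g'∈T a'∈Tj)
                   (trans (sym (insert j a g gj≡0)) (trans e (insert j a' g' g'j≡0))) j)
                 (updateAt-updates j g')) }
    }

  component-symmetric : ∀ j → Symmetric (_∈ T j)
  component-symmetric j = proj₁ (tiling-symmetric (component-tiling j))

  top : Fin m → ℕ
  top j = Symmetric.top (component-symmetric j)

  top-sum : suc (Σℕ top) ≡ P
  top-sum = ≤-antisym (sum<P (λ j → Symmetric.top∈ (component-symmetric j)))
    (subst (_≤ suc (Σℕ top)) (suc-pred P {{>-nonZero 0<P}}) (s≤s P-1≤Σtop))
    where
    P-1≤Σtop : pred P ≤ Σℕ top
    P-1≤Σtop with realise (subst (pred P <_) (suc-pred P {{>-nonZero 0<P}}) ≤-refl)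
    ... | t , t∈T , P-1≡ = subst (_≤ Σℕ top) (sym P-1≡) (Σℕ-mono (λ j → Symmetric.≤top (component-symmetric j) (t∈T j)))


sumZ : ∀ {m} → (Fin m → ℤ) → ℤ
sumZ = sumF ℤ._+_ (+ 0)

sumZ-pos : ∀ {m} (f : Fin m → ℕ) → sumZ (λ j → + f j) ≡ + Σℕ f
sumZ-pos {zero}  f = refl
sumZ-pos {suc m} f = trans (cong (λ w → + f zero ℤ.+ w) (sumZ-pos (f ∘ suc))) (sym (pos-+ (f zero) _))

sumZ-mono : ∀ {m} {f g : Fin m → ℤ} → (∀ j → f j ℤ.≤ g j) → sumZ f ℤ.≤ sumZ g
sumZ-mono {zero}  f≤g = ℤ.≤-refl
sumZ-mono {suc m} f≤g = ℤ.+-mono-≤ (f≤g zero) (sumZ-mono (f≤g ∘ suc))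

centre : ℕ → ℕ → ℤ
centre M t = + (2 * t) ℤ.- + M

uncentre : ∀ M t → centre M t ℤ.+ + M ≡ + (2 * t)
uncentre M t = sub-add (+ (2 * t)) (+ M)
  where
  sub-add : ∀ x y → (x ℤ.- y) ℤ.+ y ≡ x
  sub-add = ℤ-Solver.solve-∀

centre-injective : ∀ M {t t'} → centre M t ≡ centre M t' → t ≡ t'
centre-injective M {t} {t'} e = *-cancelˡ-≡ t t' 2
  (+-injective (trans (sym (uncentre M t)) (trans (cong (ℤ._+ + M) e) (uncentre M t'))))

centre-pos : ∀ {M t} x → x + M ≡ 2 * t → + x ≡ centre M t
centre-pos {M} x e = trans (add-sub (+ x) (+ M)) (cong (ℤ._- + M) (trans (sym (pos-+ x M)) (cong +_ e)))
  where
  add-sub : ∀ x y → x ≡ (x ℤ.+ y) ℤ.- y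
  add-sub = ℤ-Solver.solve-∀

centre-pos⁻ : ∀ {M t} x → + x ≡ centre M t → x + M ≡ 2 * t
centre-pos⁻ {M} {t} x e = +-injective (trans (pos-+ x M) (trans (cong (ℤ._+ + M) e) (uncentre M t)))

centre-neg : ∀ {M t} x → 2 * t + x ≡ M → ℤ.- (+ x) ≡ centre M t
centre-neg {t = t} x e =
  trans (neg (+ x) (+ (2 * t))) (cong (λ w → + (2 * t) ℤ.- w) (trans (sym (pos-+ (2 * t) x)) (cong +_ e)))
  where
  neg : ∀ x y → ℤ.- x ≡ y ℤ.- (y ℤ.+ x)
  neg = ℤ-Solver.solve-∀

centre-sum : ∀ {m} (M t : Fin m → ℕ) → sumZ (λ j → centre (M j) (t j)) ≡ centre (Σℕ M) (Σℕ t)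
centre-sum {zero}  M t = refl
centre-sum {suc m} M t = begin
  centre (M zero) (t zero) ℤ.+ sumZ (λ j → centre (M (suc j)) (t (suc j)))
    ≡⟨ cong (λ w → centre (M zero) (t zero) ℤ.+ w) (centre-sum (M ∘ suc) (t ∘ suc)) ⟩
  centre (M zero) (t zero) ℤ.+ centre (Σℕ (M ∘ suc)) (Σℕ (t ∘ suc))
    ≡⟨ regroup (+ (2 * t zero)) (+ M zero) (+ (2 * Σℕ (t ∘ suc))) (+ Σℕ (M ∘ suc)) ⟩
  (+ (2 * t zero) ℤ.+ + (2 * Σℕ (t ∘ suc))) ℤ.- (+ M zero ℤ.+ + Σℕ (M ∘ suc))
    ≡⟨ cong₂ ℤ._-_ (trans (sym (pos-+ (2 * t zero) _)) (cong +_ (sym (*-distribˡ-+ 2 (t zero) _))))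
                   (sym (pos-+ (M zero) _)) ⟩
  centre (Σℕ M) (Σℕ t) ∎
  where
  open ≡-Reasoning
  regroup : ∀ x y z w → (x ℤ.- y) ℤ.+ (z ℤ.- w) ≡ (x ℤ.+ z) ℤ.- (y ℤ.+ w)
  regroup = ℤ-Solver.solve-∀

-- The odd-spaced interval 2⟨P⟩ - P + 1 is ⟨P⟩ centred at P - 1.
centre-pred : ∀ {S P} k → suc S ≡ P → centre S k ≡ (+ (2 * k) ℤ.- + P) ℤ.+ + 1
centre-pred {S} k refl =
  trans (shift (+ (2 * k)) (+ S)) (cong (λ w → (+ (2 * k) ℤ.- w) ℤ.+ + 1) (sym (pos-+ 1 S)))
  where
  shift : ∀ a s → a ℤ.- s ≡ (a ℤ.- (+ 1 ℤ.+ s)) ℤ.+ + 1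
  shift = ℤ-Solver.solve-∀

centre-balance : ∀ {M t} x y → centre M t ℤ.+ + x ≡ + y ℤ.+ + M → 2 * t + x ≡ y + 2 * M
centre-balance {M} {t} x y e = +-injective (begin
  + (2 * t + x)                       ≡⟨ pos-+ (2 * t) x ⟩
  + (2 * t) ℤ.+ + x                   ≡⟨ recentre (+ (2 * t)) (+ M) (+ x) ⟩
  (centre M t ℤ.+ + x) ℤ.+ + M        ≡⟨ cong (ℤ._+ + M) e ⟩
  (+ y ℤ.+ + M) ℤ.+ + M               ≡⟨ double (+ y) (+ M) ⟩
  + y ℤ.+ + 2 ℤ.* + M                 ≡⟨ cong (ℤ._+_ (+ y)) (sym (pos-* 2 M)) ⟩
  + y ℤ.+ + (2 * M)                   ≡⟨ sym (pos-+ y (2 * M)) ⟩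
  + (y + 2 * M)                       ∎)
  where
  open ≡-Reasoning
  recentre : ∀ a m x → a ℤ.+ x ≡ ((a ℤ.- m) ℤ.+ x) ℤ.+ m
  recentre = ℤ-Solver.solve-∀
  double : ∀ y m → (y ℤ.+ m) ℤ.+ m ≡ y ℤ.+ + 2 ℤ.* m
  double = ℤ-Solver.solve-∀

record Centred (S : List ℤ) (T : List ℕ) (M : ℕ) : Set where
  field
    from-S : ∀ {z} → z ∈ S → Σ ℕ λ t → t ∈ T × z ≡ centre M t
    to-S   : ∀ {t} → t ∈ T → centre M t ∈ S

OddInterval : ℕ → ℤ → Set
OddInterval P z = ∃[ k ] (k < P × z ≡ (+ (2 * k) ℤ.- + P) ℤ.+ + 1)

module CentredSums {m} {S : Fin m → List ℤ} {T : Fin m → List ℕ} {M : Fin m → ℕ} {P : ℕ}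
  (centred : ∀ j → Centred (S j) (T j) (M j)) (top : suc (Σℕ M) ≡ P) where

  private module C j = Centred (centred j)

  from-S-sum : ∀ {z} → InSumset ℤ._+_ (+ 0) S z →
               Σ (Fin m → ℕ) λ t → (∀ j → t j ∈ T j) × z ≡ centre (Σℕ M) (Σℕ t)
  from-S-sum (s , s∈S , z≡) =
      (λ j → proj₁ (C.from-S j (s∈S j))) , (λ j → proj₁ (proj₂ (C.from-S j (s∈S j)))) ,
      trans z≡ (trans (sumF-cong ℤ._+_ (+ 0) (λ j → proj₂ (proj₂ (C.from-S j (s∈S j)))))
                      (centre-sum M _))

  to-S-sum : ∀ {t} → (∀ j → t j ∈ T j) → InSumset ℤ._+_ (+ 0) S (centre (Σℕ M) (Σℕ t))
  to-S-sum {t} t∈T = (λ j → centre (M j) (t j)) , (λ j → C.to-S j (t∈T j)) , sym (centre-sum M t)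

  sum-system⇒odd-interval : (∀ n → InSumset _+_ 0 T n ⇔ n < P) →
                            ∀ z → InSumset ℤ._+_ (+ 0) S z ⇔ OddInterval P z
  sum-system⇒odd-interval sys z = mk⇔ to from
    where
    to : InSumset ℤ._+_ (+ 0) S z → OddInterval P z
    to z∈ΣS with from-S-sum z∈ΣS
    ... | t , t∈T , z≡ = Σℕ t , Equivalence.to (sys _) (t , t∈T , refl) , trans z≡ (centre-pred (Σℕ t) top)
    from : OddInterval P z → InSumset ℤ._+_ (+ 0) S z
    from (k , k<P , z≡) with Equivalence.from (sys k) k<P
    ... | t , t∈T , k≡ =
      subst (InSumset ℤ._+_ (+ 0) S) (trans (cong (centre (Σℕ M)) (sym k≡)) (trans (centre-pred k top) (sym z≡)))
            (to-S-sum t∈T)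

  odd-interval⇒sum-system : (∀ z → InSumset ℤ._+_ (+ 0) S z ⇔ OddInterval P z) →
                            ∀ n → InSumset _+_ 0 T n ⇔ n < P
  odd-interval⇒sum-system sad n = mk⇔ to from
    where
    to : InSumset _+_ 0 T n → n < P
    to (t , t∈T , n≡) with Equivalence.to (sad _) (to-S-sum t∈T)
    ... | k , k<P , e = subst (_< P) (sym (trans n≡ (centre-injective (Σℕ M) (trans e (sym (centre-pred k top)))))) k<P
    from : n < P → InSumset _+_ 0 T n
    from n<P with from-S-sum (Equivalence.from (sad _) (n , n<P , refl))
    ... | t , t∈T , e = t , t∈T , centre-injective (Σℕ M) (trans (centre-pred n top) e)

module SortedElems (T : List ℕ) where
  private
    sort↭ = sort-↭ (dedup T)

  length-sorted : length (sortedElems T) ≡ cardℕ T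
  length-sorted = ↭-length sort↭

  ∈-sorted⁺ : ∀ {x} → x ∈ T → x ∈ sortedElems T
  ∈-sorted⁺ x∈T = ∈-resp-↭ (↭-sym sort↭) (∈-deduplicate⁺ _≟_ x∈T)

  ∈-sorted⁻ : ∀ {x} → x ∈ sortedElems T → x ∈ T
  ∈-sorted⁻ x∈s = ∈-deduplicate⁻ _≟_ T (∈-resp-↭ sort↭ x∈s)

  strictly-sorted : AllPairs _<_ (sortedElems T)
  strictly-sorted = AllPairs.zipWith (λ (x≤y , x≢y) → ≤∧≢⇒< x≤y x≢y)
    (Linked⇒AllPairs ≤-trans (sort-↗ (dedup T)) ,
     Permutation.Unique-resp-↭ (setoid ℕ) (↭⇒↭ₛ (↭-sym sort↭)) (deduplicate-! T))

nth-∈ : ∀ xs {i} → i < length xs → nth xs i ∈ xs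
nth-∈ (x ∷ xs) {zero}  _         = here refl
nth-∈ (x ∷ xs) {suc i} (s≤s i<n) = there (nth-∈ xs i<n)

∈⇒nth : ∀ {x} xs → x ∈ xs → Σ ℕ λ i → i < length xs × nth xs i ≡ x
∈⇒nth (y ∷ xs) (here refl) = 0 , z<s , refl
∈⇒nth (y ∷ xs) (there x∈xs) with ∈⇒nth xs x∈xs
... | i , i<n , e = suc i , s≤s i<n , e

Increasing : (ℕ → ℕ) → ℕ → Set
Increasing F L = ∀ {i j} → i < j → j < L → F i < F j

nth-increasing : ∀ xs → AllPairs _<_ xs → Increasing (nth xs) (length xs)
nth-increasing (x ∷ xs) (x< ∷ _)   {zero}  {suc j} _ (s≤s j<n) = All.lookup x< (nth-∈ xs j<n)
nth-increasing (x ∷ xs) (_ ∷ xs<) {suc i} {suc j} (s≤s i<j) (s≤s j<n) = nth-increasing xs xs< i<j j<n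

ImageWithin : (ℕ → ℕ) → (ℕ → ℕ) → ℕ → Set
ImageWithin F G L = ∀ {i} → i < L → Σ ℕ λ j → j < L × F i ≡ G j

module _ {F G : ℕ → ℕ} {L : ℕ} where

  private
    monotone : Increasing G L → ∀ {i j} → i ≤ j → j < L → G i ≤ G j
    monotone incG i≤j j<L with m≤n⇒m<n∨m≡n i≤j
    ... | inj₁ i<j  = <⇒≤ (incG i<j j<L)
    ... | inj₂ refl = ≤-refl

  agree-below⇒≤ : Increasing F L → Increasing G L → ImageWithin F G L →
                  ∀ {i} → i < L → (∀ {k} → k < i → F k ≡ G k) → G i ≤ F i
  agree-below⇒≤ incF incG F⊆G {i} i<L agree with F⊆G i<L
  ... | j , j<L , Fi≡Gj with i ≤? j
  ...   | yes i≤j = subst (G i ≤_) (sym Fi≡Gj) (monotone incG i≤j j<L)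
  ...   | no  i≰j = ⊥-elim (<⇒≢ (incF (≰⇒> i≰j) i<L) (trans (agree (≰⇒> i≰j)) (sym Fi≡Gj)))

increasing-unique : ∀ {F G L} → Increasing F L → Increasing G L →
                    ImageWithin F G L → ImageWithin G F L → ∀ i → i < L → F i ≡ G i
increasing-unique {F} {G} {L} incF incG F⊆G G⊆F =
  <-rec (λ i → i < L → F i ≡ G i) λ i ih i<L →
    ≤-antisym (agree-below⇒≤ incG incF G⊆F i<L (λ k<i → sym (ih k<i (<-trans k<i i<L))))
              (agree-below⇒≤ incF incG F⊆G i<L (λ k<i → ih k<i (<-trans k<i i<L)))

flip< : ∀ {i n} → i < n → n ∸ suc i < n
flip< {i} {suc n} _ = s≤s (m∸n≤m n i)

flip-flip : ∀ {i n} → i < n → n ∸ suc (n ∸ suc i) ≡ i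
flip-flip {i} {suc n} (s≤s i≤n) = m∸[m∸n]≡n i≤n

-- Let T be symmetric about M, of even size 2ν, with increasing enumeration
-- α₀ < ⋯ < α₂ᵥ₋₁.  Symmetry says α_i + α_{2ν-1-i} = M.  The differences
-- u_k = α_{ν+k} - α_{ν-1-k} (k < ν) form untilde T; they are positive and
-- distinct, and ±u_k = 2α_{ν+k} - M, 2α_{ν-1-k} - M, so that
-- untilde T ∪ -(untilde T) = 2T - M.
module Halves (T : List ℕ) (symmetric : Symmetric (_∈ T)) (even : 2 ∣ cardℕ T) where
  open Symmetric symmetric renaming (top to M)
  open SortedElems T

  s : List ℕ
  s = sortedElems T
  L : ℕ
  L = length s
  α : ℕ → ℕ
  α = nth s

  α∈T : ∀ {i} → i < L → α i ∈ T
  α∈T i<L = ∈-sorted⁻ (nth-∈ s i<L)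

  α-increasing : Increasing α L
  α-increasing = nth-increasing s strictly-sorted

  α-onto : ∀ {t} → t ∈ T → Σ ℕ λ i → i < L × α i ≡ t
  α-onto t∈T = ∈⇒nth s (∈-sorted⁺ t∈T)

  reflection : ∀ {i} → i < L → α i ≡ M ∸ α (L ∸ suc i)
  reflection {i} = increasing-unique α-increasing mirrored-increasing α⊆mirrored mirrored⊆α i
    where
    mirrored : ℕ → ℕ
    mirrored i = M ∸ α (L ∸ suc i)
    mirrored-increasing : Increasing mirrored L
    mirrored-increasing {i} {j} i<j j<L =
      ∸-monoʳ-< (α-increasing (∸-monoʳ-< (s≤s i<j) j<L) (flip< (<-trans i<j j<L)))
                (≤top (α∈T (flip< (<-trans i<j j<L))))
    α⊆mirrored : ImageWithin α mirrored L
    α⊆mirrored i<L with α-onto (reflect (α∈T i<L))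
    ... | j , j<L , αj≡ = L ∸ suc j , flip< j<L ,
          sym (trans (cong (λ k → M ∸ α k) (flip-flip j<L))
                     (trans (cong (M ∸_) αj≡) (m∸[m∸n]≡n (≤top (α∈T i<L)))))
    mirrored⊆α : ImageWithin mirrored α L
    mirrored⊆α i<L with α-onto (reflect (α∈T (flip< i<L)))
    ... | j , j<L , αj≡ = j , j<L , sym αj≡

  ν : ℕ
  ν = L / 2

  L≡ν+ν : L ≡ ν + ν
  L≡ν+ν = trans L≡2q (trans (double (quotient even)) (cong₂ _+_ (sym ν≡q) (sym ν≡q)))
    where
    L≡2q : L ≡ quotient even * 2
    L≡2q = trans length-sorted (m∣n⇒n≡quotient*m even)
    ν≡q : ν ≡ quotient even
    ν≡q = trans (cong (_/ 2) L≡2q) (m*n/n≡m (quotient even) 2)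
    double : ∀ q → q * 2 ≡ q + q
    double = solve-∀

  card-T : cardℕ T ≡ ν + ν
  card-T = trans (sym length-sorted) L≡ν+ν

  hi lo u : ℕ → ℕ
  hi k = α (ν + k)
  lo k = α (ν ∸ suc k)
  u k = hi k ∸ lo k

  module Pair {k} (k<ν : k < ν) where
    ν+k<L : ν + k < L
    ν+k<L = subst (ν + k <_) (sym L≡ν+ν) (+-monoʳ-< ν k<ν)
    lo-index<hi-index : ν ∸ suc k < ν + k
    lo-index<hi-index = <-≤-trans (flip< k<ν) (m≤m+n ν k)
    lo-index<L : ν ∸ suc k < L
    lo-index<L = <-trans lo-index<hi-index ν+k<L
    mirror : L ∸ suc (ν ∸ suc k) ≡ ν + k
    mirror = begin
      L ∸ suc w                         ≡⟨ cong (_∸ suc w) L≡ν+ν ⟩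
      (ν + ν) ∸ suc w                   ≡⟨ cong (λ n → (n + n) ∸ suc w) (sym ν≡) ⟩
      (suc (k + w) + suc (k + w)) ∸ suc w ≡⟨ cong (_∸ suc w) (regroup k w) ⟩
      (suc w + (suc (k + w) + k)) ∸ suc w ≡⟨ m+n∸m≡n (suc w) _ ⟩
      suc (k + w) + k                   ≡⟨ cong (_+ k) ν≡ ⟩
      ν + k                             ∎
      where
      open ≡-Reasoning
      w = ν ∸ suc k
      ν≡ : suc (k + w) ≡ ν
      ν≡ = m+[n∸m]≡n k<ν
      regroup : ∀ k w → suc (k + w) + suc (k + w) ≡ suc w + (suc (k + w) + k)
      regroup = solve-∀
    lo+hi : lo k + hi k ≡ M
    lo+hi = trans (cong (_+ hi k) (trans (reflection lo-index<L) (cong (λ i → M ∸ α i) mirror)))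
                  (m∸n+n≡m (≤top (α∈T ν+k<L)))
    lo<hi : lo k < hi k
    lo<hi = α-increasing lo-index<hi-index ν+k<L
    hi∈T : hi k ∈ T
    hi∈T = α∈T ν+k<L
    lo∈T : lo k ∈ T
    lo∈T = α∈T lo-index<L
    u+M : u k + M ≡ 2 * hi k
    u+M = begin
      u k + M                ≡⟨ cong (_+_ (u k)) (sym lo+hi) ⟩
      u k + (lo k + hi k)    ≡⟨ sym (+-assoc (u k) (lo k) (hi k)) ⟩
      u k + lo k + hi k      ≡⟨ cong (_+ hi k) (m∸n+n≡m (<⇒≤ lo<hi)) ⟩
      hi k + hi k            ≡⟨ cong (_+_ (hi k)) (sym (+-identityʳ (hi k))) ⟩
      2 * hi k               ∎
      where open ≡-Reasoning
    2lo+u : 2 * lo k + u k ≡ M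
    2lo+u = begin
      2 * lo k + u k         ≡⟨ cong (λ x → x + u k) (cong (_+_ (lo k)) (+-identityʳ (lo k))) ⟩
      lo k + lo k + u k      ≡⟨ +-assoc (lo k) (lo k) (u k) ⟩
      lo k + (lo k + u k)    ≡⟨ cong (_+_ (lo k)) (m+[n∸m]≡n (<⇒≤ lo<hi)) ⟩
      lo k + hi k            ≡⟨ lo+hi ⟩
      M                      ∎
      where open ≡-Reasoning

  u-increasing : Increasing u ν
  u-increasing {k} {k'} k<k' k'<ν = begin-strict
    hi k ∸ lo k   <⟨ ∸-monoˡ-< (α-increasing (+-monoʳ-< ν k<k') (Pair.ν+k<L k'<ν)) (<⇒≤ (Pair.lo<hi k<ν)) ⟩
    hi k' ∸ lo k  ≤⟨ ∸-monoʳ-≤ (hi k') (<⇒≤ (α-increasing (∸-monoʳ-< (s≤s k<k') k'<ν) (Pair.lo-index<L k<ν))) ⟩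
    hi k' ∸ lo k' ∎
    where
    open ≤-Reasoning
    k<ν = <-trans k<k' k'<ν

  untilde-positive : ∀ a → a ∈ untilde T → 1 ≤ a
  untilde-positive a a∈ with ∈-map⁻ u a∈
  ... | k , k∈ , refl = m<n⇒0<n∸m (Pair.lo<hi (∈-upTo⁻ k∈))

  card-untilde : cardℕ (untilde T) ≡ ν
  card-untilde = trans (cardℕ-unique u-unique) (trans (length-map u (upTo ν)) (length-upTo ν))
    where
    u-unique : Unique (map u (upTo ν))
    u-unique = subst Unique (sym (map-upTo u ν))
                 (Unique.applyUpTo⁺₁ u ν (λ i<j j<ν → <⇒≢ (u-increasing i<j j<ν)))

  centred : Centred (symm (untilde T)) T M
  centred = record { from-S = from-S ; to-S = to-S }
    where
    from-S : ∀ {z} → z ∈ symm (untilde T) → Σ ℕ λ t → t ∈ T × z ≡ centre M t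
    from-S z∈ with ∈-++⁻ (map +_ (untilde T)) z∈
    ... | inj₁ z∈+ with ∈-map⁻ +_ z∈+
    ...   | a , a∈ , refl with ∈-map⁻ u a∈
    ...     | k , k∈ , refl = hi k , Pair.hi∈T k<ν , centre-pos {t = hi k} (u k) (Pair.u+M k<ν)
      where k<ν = ∈-upTo⁻ k∈
    from-S z∈ | inj₂ z∈- with ∈-map⁻ (λ a → ℤ.- (+ a)) z∈-
    ...   | a , a∈ , refl with ∈-map⁻ u a∈
    ...     | k , k∈ , refl = lo k , Pair.lo∈T k<ν , centre-neg {t = lo k} (u k) (Pair.2lo+u k<ν)
      where k<ν = ∈-upTo⁻ k∈
    to-S : ∀ {t} → t ∈ T → centre M t ∈ symm (untilde T)
    to-S t∈T with α-onto t∈T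
    ... | i , i<L , refl with ν ≤? i
    ...   | yes ν≤i = subst (_∈ symm (untilde T)) (trans (centre-pos {t = hi k} (u k) (Pair.u+M k<ν)) (cong (λ j → centre M (α j)) ν+k≡i))
                        (∈-++⁺ˡ (∈-map⁺ +_ (∈-map⁺ u (∈-upTo⁺ k<ν))))
      where
      k = i ∸ ν
      ν+k≡i : ν + k ≡ i
      ν+k≡i = m+[n∸m]≡n ν≤i
      k<ν : k < ν
      k<ν = +-cancelˡ-< ν k ν (subst (_< ν + ν) (sym ν+k≡i) (subst (i <_) L≡ν+ν i<L))
    ...   | no ν≰i = subst (_∈ symm (untilde T)) (trans (centre-neg {t = lo k} (u k) (Pair.2lo+u k<ν)) (cong (λ j → centre M (α j)) (flip-flip i<ν)))
                        (∈-++⁺ʳ (map +_ (untilde T)) (∈-map⁺ (λ a → ℤ.- (+ a)) (∈-map⁺ u (∈-upTo⁺ k<ν))))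
      where
      i<ν = ≰⇒> ν≰i
      k = ν ∸ suc i
      k<ν : k < ν
      k<ν = flip< i<ν

-- The converse construction: if T₁ + ⋯ + Tₘ = ⟨N⟩ with all |Tⱼ| even, then each
-- Tⱼ is symmetric about its maximum Mⱼ, symm (untilde Tⱼ) = 2Tⱼ - Mⱼ, and
-- Σ Mⱼ = N - 1 with N = 2^m ∏ |untilde Tⱼ|; the transfer principle turns ⟨N⟩
-- into 2⟨N⟩ - N + 1.
converse : (m : ℕ) → (T : Fin m → List ℕ) → SumSystem T → ((j : Fin m) → 2 ∣ cardℕ (T j)) →
           NonInclusiveSAD (λ j → untilde (T j))
converse m T sys even =
  (λ j → H.untilde-positive j) ,
  sum-system⇒odd-interval (λ j → H.centred j) (trans top-sum N≡P)
    (subst (λ Q → ∀ n → InSumset _+_ 0 T n ⇔ n < Q) N≡P (proj₂ sys))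
  where
  open SumSystemFacts T sys
  module H j = Halves (T j) (component-symmetric j) (even j)
  open CentredSums
  N≡P : prodℕ (λ j → cardℕ (T j)) ≡ 2 ^ m * prodℕ (λ j → cardℕ (untilde (T j)))
  N≡P = trans (prodℕ-cong H.card-T)
              (trans (prodℕ-double H.ν) (cong (2 ^ m *_) (sym (prodℕ-cong H.card-untilde))))

≤maxℕ : ∀ {a} A → a ∈ A → a ≤ maxℕ A
≤maxℕ (x ∷ xs) (here refl)  = m≤m⊔n x (maxℕ xs)
≤maxℕ (x ∷ xs) (there a∈xs) = ≤-trans (≤maxℕ xs a∈xs) (m≤n⊔m x (maxℕ xs))

maxℕ-∈ : ∀ {a} A → a ∈ A → maxℕ A ∈ A
maxℕ-∈ (x ∷ xs) _ = max-∈ x xs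
  where
  max-∈ : ∀ x xs → maxℕ (x ∷ xs) ∈ x ∷ xs
  max-∈ x []       = here (⊔-identityʳ x)
  max-∈ x (y ∷ ys) with ⊔-sel x (maxℕ (y ∷ ys))
  ... | inj₁ x⊔≡x   = here x⊔≡x
  ... | inj₂ x⊔≡max = there (subst (_∈ y ∷ ys) (sym x⊔≡max) (max-∈ y ys))

map-unique : ∀ {X Y : Set} {f : X → Y} {xs} → Unique xs →
             (∀ {x y} → x ∈ xs → y ∈ xs → f x ≡ f y → x ≡ y) → Unique (map f xs)
map-unique []            _   = []
map-unique (x∉ ∷ xs!) inj =
  All.map⁺ (All.tabulate λ y∈ e → All.lookup x∉ y∈ (inj (here refl) (there y∈) e))
  ∷ map-unique xs! (λ x∈ y∈ → inj (there x∈) (there y∈))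

double : ∀ x → 2 * x ≡ x + x
double = solve-∀

half : ∀ h → (+ (2 * h)) ℚ./ 2 ≡ ℕtoℚ h
half h = fromℚᵘ-cong {mkℚᵘ (+ (2 * h)) 1} {mkℚᵘ (+ h) 0}
           (*≡* (trans (sym (pos-* (2 * h) 1)) (trans (cong +_ (regroup h)) (pos-* h 2))))
  where
  regroup : ∀ h → 2 * h * 1 ≡ h * 2
  regroup = solve-∀

module ForwardConstruction {m} (A : Fin m → List ℕ) (nonempty : ∀ j → ∃[ a ] (a ∈ A j))
                           (sad : NonInclusiveSAD A) where

  P : ℕ
  P = 2 ^ m * prodℕ (λ j → cardℕ (A j))

  S : Fin m → List ℤ
  S j = symm (A j)

  odd-interval : ∀ {z} → InSumset ℤ._+_ (+ 0) S z → OddInterval P z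
  odd-interval {z} = Equivalence.to (proj₂ sad z)

  realise : ∀ {z} → OddInterval P z → InSumset ℤ._+_ (+ 0) S z
  realise {z} = Equivalence.from (proj₂ sad z)

  M : Fin m → ℕ
  M j = maxℕ (A j)

  +∈S : ∀ {j a} → a ∈ A j → + a ∈ S j
  +∈S a∈ = ∈-++⁺ˡ (∈-map⁺ +_ a∈)

  -∈S : ∀ {j a} → a ∈ A j → ℤ.- (+ a) ∈ S j
  -∈S {j} a∈ = ∈-++⁺ʳ (map +_ (A j)) (∈-map⁺ (λ a → ℤ.- (+ a)) a∈)

  ≤M : ∀ {j s} → s ∈ S j → s ℤ.≤ + M j
  ≤M {j} s∈ with ∈-++⁻ (map +_ (A j)) s∈
  ... | inj₁ s∈+ with ∈-map⁻ +_ s∈+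
  ...   | a , a∈ , refl = ℤ.+≤+ (≤maxℕ (A j) a∈)
  ≤M {j} s∈ | inj₂ s∈- with ∈-map⁻ (λ a → ℤ.- (+ a)) s∈-
  ...   | a , a∈ , refl = neg-≤-pos

  card>0 : ∀ j → 0 < cardℕ (A j)
  card>0 j = ∈⇒length>0 (∈-deduplicate⁺ _≟_ (proj₂ (nonempty j)))
    where
    ∈⇒length>0 : ∀ {x : ℕ} {xs} → x ∈ xs → 0 < length xs
    ∈⇒length>0 {xs = _ ∷ _} _ = z<s

  P' : ℕ
  P' = pred P

  P'+1 : suc P' ≡ P
  P'+1 = suc-pred P {{>-nonZero (*-mono-< (m^n>0 2 m) (prodℕ-pos _ card>0))}}

  centred-interval : ∀ {z} → OddInterval P z → Σ ℕ λ k → k ≤ P' × z ≡ centre P' k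
  centred-interval (k , k<P , z≡) =
    k , s≤s⁻¹ (subst (k <_) (sym P'+1) k<P) , trans z≡ (sym (centre-pred k P'+1))

  -- Σ Mⱼ = P - 1: the sum of the maxima is a sum, hence at most P - 1,
  -- and P - 1 = centre P' P' is a sum, hence at most Σ Mⱼ.
  top-sum : suc (Σℕ M) ≡ P
  top-sum = trans (cong suc (≤-antisym ΣM≤P' P'≤ΣM)) P'+1
    where
    ΣM≤P' : Σℕ M ≤ P'
    ΣM≤P' with centred-interval (odd-interval ((λ j → + M j) , (λ j → +∈S (maxℕ-∈ (A j) (proj₂ (nonempty j)))) ,
                                                sym (sumZ-pos M)))
    ... | k , k≤P' , e = +-cancelʳ-≤ P' (Σℕ M) P'
          (subst (_≤ P' + P') (sym (centre-pos⁻ {t = k} (Σℕ M) e)) (subst (2 * k ≤_) (double P') (*-monoʳ-≤ 2 k≤P')))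
    P'≤ΣM : P' ≤ Σℕ M
    P'≤ΣM with realise (P' , subst (P' <_) P'+1 ≤-refl , centre-pred P' P'+1)
    ... | s , s∈S , e = drop‿+≤+ (subst₂ ℤ._≤_ (trans (sym e) (sym (centre-pos {P'} {P'} P' (sym (double P'))))) (sumZ-pos M)
                                          (sumZ-mono (λ j → ≤M (s∈S j))))

  P'≡ΣM : P' ≡ Σℕ M
  P'≡ΣM = suc-injective (trans P'+1 (sym top-sum))

  swap-max : ∀ j {s} → s ∈ S j → Σ ℕ λ k → k ≤ P' × centre P' k ℤ.+ + M j ≡ s ℤ.+ + P'
  swap-max j {s} s∈ with centred-interval (odd-interval (G , ≔-∈ j (λ i → +∈S (maxℕ-∈ (A i) (proj₂ (nonempty i)))) s∈ , refl))
    where G = (λ i → + M i) [ j ]≔ s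
  ... | k , k≤P' , e = k , k≤P' , (begin
    centre P' k ℤ.+ + M j                   ≡⟨ cong (ℤ._+ + M j) (sym e) ⟩
    sumZ ((λ i → + M i) [ j ]≔ s) ℤ.+ + M j ≡⟨ sumF-≔ ℤ.+-0-commutativeMonoid (λ i → + M i) j s ⟩
    s ℤ.+ sumZ (λ i → + M i)                ≡⟨ cong (ℤ._+_ s) (trans (sumZ-pos M) (cong +_ (sym P'≡ΣM))) ⟩
    s ℤ.+ + P'                              ∎)
    where open ≡-Reasoning

  -- Mⱼ - a and Mⱼ + a are even for a ∈ Aⱼ: both are 2 (P' - k) for the k of swap-max.
  private
    halve : ∀ {k x y} → k ≤ P' → 2 * k + x ≡ y + 2 * P' → x ≡ y + 2 * (P' ∸ k)
    halve {k} {x} {y} k≤P' e = +-cancelˡ-≡ (2 * k) _ _ (begin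
      2 * k + x                     ≡⟨ e ⟩
      y + 2 * P'                    ≡⟨ cong (λ p → y + 2 * p) (sym (m+[n∸m]≡n k≤P')) ⟩
      y + 2 * (k + (P' ∸ k))        ≡⟨ regroup y k (P' ∸ k) ⟩
      2 * k + (y + 2 * (P' ∸ k))    ∎)
      where
      open ≡-Reasoning
      regroup : ∀ y k w → y + 2 * (k + w) ≡ 2 * k + (y + 2 * w)
      regroup = solve-∀

  even-below : ∀ {j a} → a ∈ A j → Σ ℕ λ w → M j ≡ a + 2 * w
  even-below {j} {a} a∈ with swap-max j (+∈S a∈)
  ... | k , k≤P' , e = P' ∸ k , halve {y = a} k≤P' (centre-balance {P'} {k} (M j) a e)

  even-above : ∀ {j a} → a ∈ A j → Σ ℕ λ w → M j + a ≡ 2 * w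
  even-above {j} {a} a∈ with swap-max j (-∈S a∈)
  ... | k , k≤P' , e = P' ∸ k , halve {y = 0} k≤P' (centre-balance {P'} {k} (M j + a) 0 (begin
    centre P' k ℤ.+ + (M j + a)         ≡⟨ cong (ℤ._+_ (centre P' k)) (pos-+ (M j) a) ⟩
    centre P' k ℤ.+ (+ M j ℤ.+ + a)     ≡⟨ regroup (centre P' k) (+ M j) (+ a) ⟩
    (centre P' k ℤ.+ + M j) ℤ.+ + a     ≡⟨ cong (ℤ._+ + a) e ⟩
    (ℤ.- (+ a) ℤ.+ + P') ℤ.+ + a        ≡⟨ cancel (+ a) (+ P') ⟩
    + 0 ℤ.+ + P'                        ∎))
    where
    open ≡-Reasoning
    regroup : ∀ c m a → c ℤ.+ (m ℤ.+ a) ≡ (c ℤ.+ m) ℤ.+ a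
    regroup = ℤ-Solver.solve-∀
    cancel : ∀ a p → (ℤ.- a ℤ.+ p) ℤ.+ a ≡ + 0 ℤ.+ p
    cancel = ℤ-Solver.solve-∀

  lower upper : Fin m → ℕ → ℕ
  lower j a = (M j ∸ a) / 2
  upper j a = (M j + a) / 2

  B : Fin m → List ℕ
  B j = map (lower j) (dedup (A j)) ++ map (upper j) (dedup (A j))

  private
    halve-double : ∀ w → 2 * w / 2 ≡ w
    halve-double w = trans (cong (_/ 2) (*-comm 2 w)) (m*n/n≡m w 2)

  lower-spec : ∀ {j a} → a ∈ A j → 2 * lower j a + a ≡ M j
  lower-spec {j} {a} a∈ with even-below a∈
  ... | w , M≡ = begin
    2 * ((M j ∸ a) / 2) + a ≡⟨ cong (λ x → 2 * (x / 2) + a) (trans (cong (_∸ a) M≡) (m+n∸m≡n a (2 * w))) ⟩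
    2 * (2 * w / 2) + a     ≡⟨ cong (λ x → 2 * x + a) (halve-double w) ⟩
    2 * w + a               ≡⟨ +-comm (2 * w) a ⟩
    a + 2 * w               ≡⟨ sym M≡ ⟩
    M j                     ∎
    where open ≡-Reasoning

  upper-spec : ∀ {j a} → a ∈ A j → a + M j ≡ 2 * upper j a
  upper-spec {j} {a} a∈ with even-above a∈
  ... | w , M+a≡ = begin
    a + M j               ≡⟨ +-comm a (M j) ⟩
    M j + a               ≡⟨ M+a≡ ⟩
    2 * w                 ≡⟨ cong (2 *_) (sym (halve-double w)) ⟩
    2 * (2 * w / 2)       ≡⟨ cong (λ x → 2 * (x / 2)) (sym M+a≡) ⟩
    2 * ((M j + a) / 2)   ∎
    where open ≡-Reasoning

  lower∈B : ∀ {j a} → a ∈ A j → lower j a ∈ B j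
  lower∈B a∈ = ∈-++⁺ˡ (∈-map⁺ _ (∈-deduplicate⁺ _≟_ a∈))

  upper∈B : ∀ {j a} → a ∈ A j → upper j a ∈ B j
  upper∈B {j} a∈ = ∈-++⁺ʳ (map (lower j) (dedup (A j))) (∈-map⁺ _ (∈-deduplicate⁺ _≟_ a∈))

  -- Sⱼ = 2Bⱼ - Mⱼ: a = 2 upper - M and -a = 2 lower - M.
  centred : ∀ j → Centred (S j) (B j) (M j)
  centred j = record { from-S = from-S ; to-S = to-S }
    where
    from-S : ∀ {s} → s ∈ S j → Σ ℕ λ t → t ∈ B j × s ≡ centre (M j) t
    from-S s∈ with ∈-++⁻ (map +_ (A j)) s∈
    ... | inj₁ s∈+ with ∈-map⁻ +_ s∈+
    ...   | a , a∈ , refl = upper j a , upper∈B a∈ , centre-pos {t = upper j a} a (upper-spec a∈)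
    from-S s∈ | inj₂ s∈- with ∈-map⁻ (λ a → ℤ.- (+ a)) s∈-
    ...   | a , a∈ , refl = lower j a , lower∈B a∈ , centre-neg {t = lower j a} a (lower-spec a∈)
    to-S : ∀ {t} → t ∈ B j → centre (M j) t ∈ S j
    to-S t∈ with ∈-++⁻ (map (lower j) (dedup (A j))) t∈
    ... | inj₁ t∈lower with ∈-map⁻ (lower j) t∈lower
    ...   | a , a∈ , refl = subst (_∈ S j) (centre-neg {t = lower j a} a (lower-spec (∈-deduplicate⁻ _≟_ (A j) a∈)))
                                  (-∈S (∈-deduplicate⁻ _≟_ (A j) a∈))
    to-S t∈ | inj₂ t∈upper with ∈-map⁻ (upper j) t∈upper
    ...   | a , a∈ , refl = subst (_∈ S j) (centre-pos {t = upper j a} a (upper-spec (∈-deduplicate⁻ _≟_ (A j) a∈)))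
                                  (+∈S (∈-deduplicate⁻ _≟_ (A j) a∈))

  -- |Bⱼ| = 2|Aⱼ|: the halves are distinct, lower ones at most Mⱼ/2 < upper ones.
  card-B : ∀ j → cardℕ (B j) ≡ cardℕ (A j) + cardℕ (A j)
  card-B j = trans (cardℕ-unique B-unique)
    (trans (length-++ (map (lower j) D)) (cong₂ _+_ (length-map (lower j) D) (length-map (upper j) D)))
    where
    D = dedup (A j)
    in-A : ∀ {a} → a ∈ D → a ∈ A j
    in-A = ∈-deduplicate⁻ _≟_ (A j)
    lower-injective : ∀ {a a'} → a ∈ D → a' ∈ D → lower j a ≡ lower j a' → a ≡ a'
    lower-injective {a} {a'} a∈ a'∈ e = +-cancelˡ-≡ (2 * lower j a) a a'
      (trans (lower-spec (in-A a∈)) (trans (sym (lower-spec (in-A a'∈))) (cong (λ x → 2 * x + a') (sym e))))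
    upper-injective : ∀ {a a'} → a ∈ D → a' ∈ D → upper j a ≡ upper j a' → a ≡ a'
    upper-injective {a} {a'} a∈ a'∈ e = +-cancelʳ-≡ (M j) a a'
      (trans (upper-spec (in-A a∈)) (trans (cong (2 *_) e) (sym (upper-spec (in-A a'∈)))))
    lower<upper : ∀ {a a'} → a ∈ D → a' ∈ D → 2 * lower j a < 2 * upper j a'
    lower<upper {a} {a'} a∈ a'∈ = begin-strict
      2 * lower j a   ≤⟨ m≤m+n (2 * lower j a) a ⟩
      2 * lower j a + a ≡⟨ lower-spec (in-A a∈) ⟩
      M j             <⟨ m<n+m (M j) (proj₁ sad j a' (in-A a'∈)) ⟩
      a' + M j        ≡⟨ upper-spec (in-A a'∈) ⟩
      2 * upper j a'  ∎
      where open ≤-Reasoning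
    apart : ∀ {v} → ¬ (v ∈ map (lower j) D × v ∈ map (upper j) D)
    apart (v∈lower , v∈upper) with ∈-map⁻ (lower j) v∈lower | ∈-map⁻ (upper j) v∈upper
    ... | a , a∈ , refl | a' , a'∈ , e = <⇒≢ (lower<upper a∈ a'∈) (cong (2 *_) e)
    B-unique : Unique (B j)
    B-unique = Unique.++⁺ (map-unique (deduplicate-! (A j)) lower-injective)
                          (map-unique (deduplicate-! (A j)) upper-injective) apart

  prodℕ-B : prodℕ (λ j → cardℕ (B j)) ≡ P
  prodℕ-B = trans (prodℕ-cong card-B) (prodℕ-double (λ j → cardℕ (A j)))

  sum-system : SumSystem B
  sum-system = (λ j → subst (2 ≤_) (sym (card-B j)) (+-mono-≤ (card>0 j) (card>0 j))) ,
               subst (λ Q → ∀ n → InSumset _+_ 0 B n ⇔ n < Q) (sym prodℕ-B)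
                     (odd-interval⇒sum-system centred top-sum (proj₂ sad))
    where open CentredSums

  B-even : ∀ j → 2 ∣ cardℕ (B j)
  B-even j = divides (cardℕ (A j)) (trans (card-B j) (+-comm-double (cardℕ (A j))))
    where
    +-comm-double : ∀ c → c + c ≡ c * 2
    +-comm-double = solve-∀

  tilde≡B : ∀ j q → q ∈ tilde (A j) ⇔ q ∈ map ℕtoℚ (B j)
  tilde≡B j q = mk⇔ to from
    where
    halves : ℕ → List ℚ
    halves a = ((+ M j ℤ.- + a) ℚ./ 2) ∷ ((+ M j ℤ.+ + a) ℚ./ 2) ∷ []
    lower-ℚ : ∀ {a} → a ∈ A j → (+ M j ℤ.- + a) ℚ./ 2 ≡ ℕtoℚ (lower j a)
    lower-ℚ {a} a∈ = begin
      (+ M j ℤ.- + a) ℚ./ 2                     ≡⟨ cong (λ x → (+ x ℤ.- + a) ℚ./ 2) (sym (lower-spec a∈)) ⟩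
      (+ (2 * lower j a + a) ℤ.- + a) ℚ./ 2     ≡⟨ cong (λ x → (x ℤ.- + a) ℚ./ 2) (pos-+ (2 * lower j a) a) ⟩
      ((+ (2 * lower j a) ℤ.+ + a) ℤ.- + a) ℚ./ 2 ≡⟨ cong (ℚ._/ 2) (add-sub (+ (2 * lower j a)) (+ a)) ⟩
      (+ (2 * lower j a)) ℚ./ 2                 ≡⟨ half (lower j a) ⟩
      ℕtoℚ (lower j a)                          ∎
      where
      open ≡-Reasoning
      add-sub : ∀ x y → (x ℤ.+ y) ℤ.- y ≡ x
      add-sub = ℤ-Solver.solve-∀
    upper-ℚ : ∀ {a} → a ∈ A j → (+ M j ℤ.+ + a) ℚ./ 2 ≡ ℕtoℚ (upper j a)
    upper-ℚ {a} a∈ = begin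
      (+ M j ℤ.+ + a) ℚ./ 2         ≡⟨ cong (ℚ._/ 2) (sym (pos-+ (M j) a)) ⟩
      (+ (M j + a)) ℚ./ 2           ≡⟨ cong (λ x → (+ x) ℚ./ 2) (trans (+-comm (M j) a) (upper-spec a∈)) ⟩
      (+ (2 * upper j a)) ℚ./ 2     ≡⟨ half (upper j a) ⟩
      ℕtoℚ (upper j a)              ∎
      where open ≡-Reasoning
    to : q ∈ tilde (A j) → q ∈ map ℕtoℚ (B j)
    to q∈ with find (∈-concatMap⁻ halves {xs = A j} q∈)
    ... | a , a∈ , here q≡        = subst (_∈ map ℕtoℚ (B j)) (sym (trans q≡ (lower-ℚ a∈))) (∈-map⁺ ℕtoℚ (lower∈B a∈))
    ... | a , a∈ , there (here q≡) = subst (_∈ map ℕtoℚ (B j)) (sym (trans q≡ (upper-ℚ a∈))) (∈-map⁺ ℕtoℚ (upper∈B a∈))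
    from : q ∈ map ℕtoℚ (B j) → q ∈ tilde (A j)
    from q∈ with ∈-map⁻ ℕtoℚ q∈
    ... | b , b∈ , refl with ∈-++⁻ (map (lower j) (dedup (A j))) b∈
    ...   | inj₁ b∈lower with ∈-map⁻ (lower j) b∈lower
    ...     | a , a∈ , refl = ∈-concatMap⁺ halves (lose a∈A (here (sym (lower-ℚ a∈A))))
      where a∈A = ∈-deduplicate⁻ _≟_ (A j) a∈
    from q∈ | b , b∈ , refl | inj₂ b∈upper with ∈-map⁻ (upper j) b∈upper
    ...     | a , a∈ , refl = ∈-concatMap⁺ halves (lose a∈A (there (here (sym (upper-ℚ a∈A)))))
      where a∈A = ∈-deduplicate⁻ _≟_ (A j) a∈

forward : (m : ℕ) → (A : Fin m → List ℕ) → ((j : Fin m) → ∃[ a ] (a ∈ A j)) → NonInclusiveSAD A →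
          Σ (Fin m → List ℕ) λ B →
            ((j : Fin m) → (q : ℚ) → q ∈ tilde (A j) ⇔ q ∈ map ℕtoℚ (B j)) ×
            SumSystem B × ((j : Fin m) → 2 ∣ cardℕ (B j))
forward m A nonempty sad = B , tilde≡B , sum-system , B-even
  where open ForwardConstruction A nonempty sad

-- Both directions; neither needs the hypothesis m ≥ 1.
theorem2 :
    ((m : ℕ) → 1 ≤ m → (A : Fin m → List ℕ) →
      ((j : Fin m) → ∃[ a ] (a ∈ A j)) →
      NonInclusiveSAD A →
      Σ (Fin m → List ℕ) λ B →
        ((j : Fin m) → (q : ℚ) → q ∈ tilde (A j) ⇔ q ∈ map ℕtoℚ (B j)) ×
        SumSystem B ×
        ((j : Fin m) → 2 ∣ cardℕ (B j)))
    ×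
    ((m : ℕ) → 1 ≤ m → (T : Fin m → List ℕ) →
      SumSystem T →
      ((j : Fin m) → 2 ∣ cardℕ (T j)) →
      NonInclusiveSAD (λ j → untilde (T j)))
theorem2 = (λ m _ → forward m) , (λ m _ → converse m)
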